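{- There exist connected graphs $G$ and $H$ with $H\subset G$ ($H$ a subgraph of $G$) such that both $\mathrm{edim}(H)-\mathrm{edim}(G)$ and $\mathrm{edim}_f(H)-\mathrm{edim}_f(G)$ can be arbitrarily large; that is, for every real $M$ there exist connected graphs $H\subset G$ with $\mathrm{edim}(H)-\mathrm{edim}(G)>M$ and $\mathrm{edim}_f(H)-\mathrm{edim}_f(G)>M$.
   Context: All graphs are finite, simple, undirected and connected; $d(u,w)$ is the length of a shortest $u$–$w$ path. For a vertex $v$ and an edge $e=xy$, $d(e,v)=\min\{d(x,v),d(y,v)\}$. For distinct edges $e_1,e_2$, $R_e\{e_1,e_2\}=\{v\in V(G): d(v,e_1)\neq d(v,e_2)\}$. A set $S\subseteq V(G)$ is an edge resolving set of $G$ if $S\cap R_e\{e_1,e_2\}\neq\emptyset$ for all distinct edges $e_1,e_2$; $\mathrm{edim}(G)$ is the minimum cardinality of an edge resolving set. For $g:V(G)\to\mathbb{R}$ and $U\subseteq V(G)$, $g(U)=\sum_{s\in U}g(s)$. A function $g:V(G)\to[0,1]$ is an edge resolving function of $G$ if $g(R_e\{e_1,e_2\})\ge1$ for all distinct edges $e_1,e_2$; $\mathrm{edim}_f(G)=\min\{g(V(G)): g\text{ is an edge resolving function of }G\}$. -}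

module Defs where

open import Data.Bool using (Bool; true; false; _∧_; _∨_; not; if_then_else_)
open import Data.Nat using (ℕ; zero; suc; _⊓_; _≡ᵇ_)
import Data.Nat as ℕ
open import Data.Fin using (Fin; toℕ; _<_)
open import Data.Fin.Properties using (_≟_)
open import Data.Fin.Subset using (Subset; _∈_; ∣_∣)
open import Data.List using (List; upTo; foldr)
open import Data.Bool.ListAction using (any)
open import Data.List.Base using (allFin)
open import Data.Product using (Σ; ∃; ∃-syntax; _×_; _,_)
open import Data.Integer using (+_)
open import Data.Rational using (ℚ; _/_; 0ℚ; 1ℚ) renaming (_≤_ to _≤ℚ_; _+_ to _+ℚ_)
open import Relation.Binary.PropositionalEquality using (_≡_; _≢_)
open import Relation.Nullary.Decidable using (⌊_⌋)
open import Function.Definitions using (Injective)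

record Graph : Set where
  field
    n     : ℕ
    adj   : Fin n → Fin n → Bool
    sym   : ∀ u v → adj u v ≡ adj v u
    irrefl : ∀ u → adj u u ≡ false
open Graph public

reach : (G : Graph) → ℕ → Fin (n G) → Fin (n G) → Bool
reach G zero    u v = ⌊ u ≟ v ⌋
reach G (suc k) u v = reach G k u v ∨ any (λ w → reach G k u w ∧ adj G w v) (allFin (n G))

Connected : Graph → Set
Connected G = ∀ u v → ∃[ k ] (reach G k u v ≡ true)

-- d(u,v): the least k with a u–v walk of length ≤ k; computed as the number of
-- k ∈ {0,…,n-1} for which v is not within distance k of u (correct for connected G,
-- where every distance is at most n-1).
dist : (G : Graph) → Fin (n G) → Fin (n G) → ℕ
dist G u v = foldr (λ k acc → if reach G k u v then acc else suc acc) 0 (upTo (n G))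

-- Edges {x,y} represented with x < y (so each edge is counted once).
Edge : Graph → Set
Edge G = Σ (Fin (n G)) λ x → Σ (Fin (n G)) λ y → (x < y) × (adj G x y ≡ true)

endpoints : (G : Graph) → Edge G → Fin (n G) × Fin (n G)
endpoints G (x , y , _) = x , y

DistinctEdges : (G : Graph) → Edge G → Edge G → Set
DistinctEdges G e₁ e₂ = endpoints G e₁ ≢ endpoints G e₂

edgeDist : (G : Graph) → Edge G → Fin (n G) → ℕ
edgeDist G (x , y , _) v = dist G x v ⊓ dist G y v

inRe : (G : Graph) → Edge G → Edge G → Fin (n G) → Bool
inRe G e₁ e₂ v = not (edgeDist G e₁ v ≡ᵇ edgeDist G e₂ v)

IsEdgeResolvingSet : (G : Graph) → Subset (n G) → Set
IsEdgeResolvingSet G S = ∀ e₁ e₂ → DistinctEdges G e₁ e₂ →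
  ∃[ v ] (v ∈ S × edgeDist G e₁ v ≢ edgeDist G e₂ v)

IsEdim : Graph → ℕ → Set
IsEdim G k = (∃[ S ] (IsEdgeResolvingSet G S × ∣ S ∣ ≡ k))
           × (∀ S → IsEdgeResolvingSet G S → k ℕ.≤ ∣ S ∣)

sumOver : (G : Graph) → (Fin (n G) → Bool) → (Fin (n G) → ℚ) → ℚ
sumOver G U g = foldr (λ v acc → (if U v then g v else 0ℚ) +ℚ acc) 0ℚ (allFin (n G))

total : (G : Graph) → (Fin (n G) → ℚ) → ℚ
total G g = sumOver G (λ _ → true) g

IsEdgeResolvingFunction : (G : Graph) → (Fin (n G) → ℚ) → Set
IsEdgeResolvingFunction G g =
  (∀ v → (0ℚ ≤ℚ g v) × (g v ≤ℚ 1ℚ)) ×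
  (∀ e₁ e₂ → DistinctEdges G e₁ e₂ → 1ℚ ≤ℚ sumOver G (inRe G e₁ e₂) g)

IsEdimF : Graph → ℚ → Set
IsEdimF G q = (∃[ g ] (IsEdgeResolvingFunction G g × total G g ≡ q))
            × (∀ g → IsEdgeResolvingFunction G g → q ≤ℚ total G g)

-- H ⊆ G: an injective vertex map sending edges of H to edges of G
-- (H is, up to isomorphism, a subgraph of G).
_⊆G_ : Graph → Graph → Set
H ⊆G G = ∃[ f ] (Injective _≡_ _≡_ f ×
                 (∀ u v → adj H u v ≡ true → adj G (f u) (f v) ≡ true))

ℕtoℚ : ℕ → ℚ
ℕtoℚ k = + k / 1

-- Take G = the 3 × m grid and H ⊆ G the comb (the middle row with all vertical edges),
-- m = K + 2. In G the two top corners already tell every two edges apart, and the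
-- four pairs of edges meeting at the corners of the grid are distinguished only by
-- vertices on a row or column through that corner, so every vertex serves at most two
-- of these pairs; by double counting, an edge resolving function has weight at least 2.
-- In H the top row resolves all edges, while the two teeth of column j are at equal
-- distance from every vertex outside column j, so each column needs weight 1. Hence
-- edim and edim_f are 2 for G and m for H, and both differences equal K.
module Submission where

-- The development lives in its own module so that ℕ's _<_ does not clash with the
-- rational _<_ of the statement.
module EdgeDimensions where

  open import Algebra.Bundles using (Ring)
  open import Data.Bool using (Bool; true; false; T; _∧_; _xor_; not; if_then_else_)
  open import Data.Bool.Properties using (T-≡; T-∧; T-∨)
  open import Data.Empty using (⊥-elim)
  open import Data.Fin using (Fin; zero; suc; toℕ; fromℕ<; combine; remQuot; _↑ˡ_; _↑ʳ_)
  import Data.Fin.Properties as Fin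
  open import Data.Fin.Subset using (Subset; inside; outside; _∈_; _∪_; ⁅_⁆; ∣_∣)
  open import Data.Fin.Subset.Properties using (∣p∣≤∣x∷p∣; ∣⁅x⁆∣≡1; x∈⁅x⁆; x∈p∪q⁺; _∈?_)
  import Data.Integer as ℤ
  import Data.Integer.Properties as ℤ
  open import Data.List using ([]; _∷_; foldr; tabulate; upTo; _∷ʳ_)
  open import Data.List.Base using (allFin)
  open import Data.List.Properties using (upTo-∷ʳ; foldr-∷ʳ)
  open import Data.List.Membership.Propositional using (lose)
  open import Data.List.Membership.Propositional.Properties using (∈-allFin)
  open import Data.List.Relation.Unary.Any using (satisfied)
  open import Data.List.Relation.Unary.Any.Properties using (any⁺; any⁻)
  open import Data.Nat using (ℕ; zero; suc; _+_; _*_; _≤_; _<_; _≡ᵇ_; _⊓_; ∣_-_∣; z≤n; s≤s)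
  open import Data.Nat.Coprimality using (1-coprimeTo)
  import Data.Nat.Coprimality as Coprime
  open import Data.Nat.Properties
  open import Data.Nat.Tactic.RingSolver using (solve-∀)
  open import Algebra.Properties.CommutativeSemigroup +-commutativeSemigroup using (interchange)
  open import Data.Product using (∃-syntax; _×_; _,_; proj₁; proj₂; uncurry)
  open import Data.Sum using (_⊎_; inj₁; inj₂; [_,_]′)
  open import Function.Bundles using (Equivalence)
  open import Data.Rational using (ℚ; mkℚ; _/_; 0ℚ; 1ℚ; *≤*; *<*; drop-*≤*; nonNegative)
    renaming (_+_ to _+ℚ_; _*_ to _*ℚ_; -_ to -ℚ_; _-_ to _-ℚ_; _≤_ to _≤ℚ_; _<_ to _<ℚ_)
  import Data.Rational.Properties as ℚ
  open import Algebra.Properties.Semiring.Sum (Ring.semiring ℚ.+-*-ring)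
    using (sum; sum-syntax; ∑-comm; sum-cong-≗; *-distribˡ-sum)
  open import Data.Vec using (lookup; []; _∷_)
  open import Data.Vec.Properties using ([]=⇒lookup; lookup⇒[]=; lookup∘tabulate)
  import Data.Vec as Vec
  open import Function using (_∘_)
  open import Relation.Binary using (tri<; tri≈; tri>)
  open import Relation.Binary.PropositionalEquality
  open import Relation.Nullary using (Dec; does; yes; no; ¬_)
  open import Relation.Nullary.Decidable using (⌊_⌋; toWitness; fromWitness; dec-true; _×-dec_; _⊎-dec_)

  open import Defs hiding (sym)

  ℕtoℚ≡mkℚ : ∀ k → ℕtoℚ k ≡ mkℚ (ℤ.+ k) 0 (Coprime.sym (1-coprimeTo k))
  ℕtoℚ≡mkℚ k = ℚ.normalize-coprime (Coprime.sym (1-coprimeTo k))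

  ℕtoℚ-suc : ∀ k → ℕtoℚ (suc k) ≡ 1ℚ +ℚ ℕtoℚ k
  ℕtoℚ-suc k rewrite ℕtoℚ≡mkℚ k = cong (λ z → (ℤ.+ 1 ℤ.+ z) / 1) (sym (ℤ.*-identityʳ (ℤ.+ k)))

  ℕtoℚ-+ : ∀ a b → ℕtoℚ (a + b) ≡ ℕtoℚ a +ℚ ℕtoℚ b
  ℕtoℚ-+ zero    b = sym (ℚ.+-identityˡ (ℕtoℚ b))
  ℕtoℚ-+ (suc a) b rewrite ℕtoℚ-suc (a + b) | ℕtoℚ-suc a | ℕtoℚ-+ a b =
    sym (ℚ.+-assoc 1ℚ (ℕtoℚ a) (ℕtoℚ b))

  ℕtoℚ-mono-≤ : ∀ {a b} → a ≤ b → ℕtoℚ a ≤ℚ ℕtoℚ b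
  ℕtoℚ-mono-≤ {a} {b} a≤b rewrite ℕtoℚ≡mkℚ a | ℕtoℚ≡mkℚ b =
    *≤* (subst₂ ℤ._≤_ (sym (ℤ.*-identityʳ (ℤ.+ a))) (sym (ℤ.*-identityʳ (ℤ.+ b))) (ℤ.+≤+ a≤b))

  ℕtoℚ-cancel-≤ : ∀ {a b} → ℕtoℚ a ≤ℚ ℕtoℚ b → a ≤ b
  ℕtoℚ-cancel-≤ {a} {b} le rewrite ℕtoℚ≡mkℚ a | ℕtoℚ≡mkℚ b with drop-*≤* le
  ... | z rewrite ℤ.*-identityʳ (ℤ.+ a) | ℤ.*-identityʳ (ℤ.+ b) = ℤ.drop‿+≤+ z

  select : Bool → ℚ → ℚ
  select b x = if b then x else 0ℚ

  select-nonNeg : ∀ b {x} → 0ℚ ≤ℚ x → 0ℚ ≤ℚ select b x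
  select-nonNeg true  0≤x = 0≤x
  select-nonNeg false _   = ℚ.≤-refl

  foldr-tabulate : ∀ {j k} (f : Fin j → Fin k) (h : Fin k → ℚ) →
    foldr (λ v acc → h v +ℚ acc) 0ℚ (tabulate f) ≡ ∑[ i < j ] h (f i)
  foldr-tabulate {zero}  f h = refl
  foldr-tabulate {suc j} f h = cong (h (f zero) +ℚ_) (foldr-tabulate (f ∘ suc) h)

  sumOver≡∑ : ∀ G U g → sumOver G U g ≡ ∑[ v < n G ] select (U v) (g v)
  sumOver≡∑ G U g = foldr-tabulate (λ v → v) (λ v → select (U v) (g v))

  ∑-mono-≤ : ∀ {k} {f g : Fin k → ℚ} → (∀ i → f i ≤ℚ g i) → sum f ≤ℚ sum g
  ∑-mono-≤ {zero}  f≤g = ℚ.≤-refl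
  ∑-mono-≤ {suc k} f≤g = ℚ.+-mono-≤ (f≤g zero) (∑-mono-≤ (f≤g ∘ suc))

  ∑-nonNeg : ∀ {k} {f : Fin k → ℚ} → (∀ i → 0ℚ ≤ℚ f i) → 0ℚ ≤ℚ sum f
  ∑-nonNeg {zero}  _   = ℚ.≤-refl
  ∑-nonNeg {suc k} f≥0 = ℚ.+-mono-≤ (f≥0 zero) (∑-nonNeg (f≥0 ∘ suc))

  term≤∑ : ∀ {k} {f : Fin k → ℚ} → (∀ i → 0ℚ ≤ℚ f i) → ∀ i → f i ≤ℚ sum f
  term≤∑ {suc k} {f} f≥0 zero =
    subst (_≤ℚ sum f) (ℚ.+-identityʳ (f zero)) (ℚ.+-monoʳ-≤ (f zero) (∑-nonNeg (f≥0 ∘ suc)))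
  term≤∑ {suc k} {f} f≥0 (suc i) =
    subst (_≤ℚ sum f) (ℚ.+-identityˡ (f (suc i))) (ℚ.+-mono-≤ (f≥0 zero) (term≤∑ (f≥0 ∘ suc) i))

  ∑-ones : ∀ k → ∑[ i < k ] 1ℚ ≡ ℕtoℚ k
  ∑-ones zero    = refl
  ∑-ones (suc k) = trans (cong (1ℚ +ℚ_) (∑-ones k)) (sym (ℕtoℚ-suc k))

  ∑-↑ : ∀ a b (f : Fin (a + b) → ℚ) → sum f ≡ ∑[ i < a ] f (i ↑ˡ b) +ℚ ∑[ j < b ] f (a ↑ʳ j)
  ∑-↑ zero    b f = sym (ℚ.+-identityˡ _)
  ∑-↑ (suc a) b f rewrite ∑-↑ a b (f ∘ suc) = sym (ℚ.+-assoc (f zero) _ _)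

  ∑-combine : ∀ a b (f : Fin (a * b) → ℚ) → sum f ≡ ∑[ i < a ] ∑[ j < b ] f (combine i j)
  ∑-combine zero    b f = refl
  ∑-combine (suc a) b f rewrite ∑-↑ b (a * b) f | ∑-combine a b (λ k → f (b ↑ʳ k)) = refl

  indicator : ∀ {k} → Subset k → Fin k → ℚ
  indicator S v = select (lookup S v) 1ℚ

  ∑-indicator : ∀ {k} (S : Subset k) → sum (indicator S) ≡ ℕtoℚ ∣ S ∣
  ∑-indicator []             = refl
  ∑-indicator (inside ∷ S)  = trans (cong (1ℚ +ℚ_) (∑-indicator S)) (sym (ℕtoℚ-suc ∣ S ∣))
  ∑-indicator (outside ∷ S) = trans (ℚ.+-identityˡ _) (∑-indicator S)

  count : ∀ {k} → (Fin k → Bool) → ℕ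
  count {zero}  b = 0
  count {suc k} b = (if b zero then 1 else 0) + count (b ∘ suc)

  ∑-select≡count* : ∀ {k} (b : Fin k → Bool) x → ∑[ i < k ] select (b i) x ≡ ℕtoℚ (count b) *ℚ x
  ∑-select≡count* {zero}  b x = sym (ℚ.*-zeroˡ x)
  ∑-select≡count* {suc k} b x with b zero
  ... | true  = begin
    x +ℚ ∑[ i < k ] select (b (suc i)) x      ≡⟨ cong (x +ℚ_) (∑-select≡count* (b ∘ suc) x) ⟩
    x +ℚ ℕtoℚ c *ℚ x         ≡⟨ cong (_+ℚ ℕtoℚ c *ℚ x) (sym (ℚ.*-identityˡ x)) ⟩
    1ℚ *ℚ x +ℚ ℕtoℚ c *ℚ x   ≡⟨ sym (ℚ.*-distribʳ-+ x 1ℚ (ℕtoℚ c)) ⟩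
    (1ℚ +ℚ ℕtoℚ c) *ℚ x      ≡⟨ cong (_*ℚ x) (sym (ℕtoℚ-suc c)) ⟩
    ℕtoℚ (suc c) *ℚ x        ∎
    where
    open ≡-Reasoning
    c : ℕ
    c = count (b ∘ suc)
  ... | false = trans (ℚ.+-identityˡ _) (∑-select≡count* (b ∘ suc) x)

  count-mono : ∀ {k} {b c : Fin k → Bool} → (∀ i → b i ≡ true → c i ≡ true) → count b ≤ count c
  count-mono {zero}              _   = z≤n
  count-mono {suc k} {b} {c} b⇒c with b zero in eq | c zero in eq′
  ... | true  | true  = s≤s (count-mono (b⇒c ∘ suc))
  ... | true  | false with () ← trans (sym (b⇒c zero eq)) eq′
  ... | false | true  = m≤n⇒m≤1+n (count-mono (b⇒c ∘ suc))
  ... | false | false = count-mono (b⇒c ∘ suc)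

  count-single : ∀ {k} (b : Fin k → Bool) i₀ → (∀ i → i ≢ i₀ → b i ≡ false) → count b ≤ 1
  count-single {suc k} b zero others =
    +-mono-≤ (if-≤1 (b zero)) (≤-reflexive (none (b ∘ suc) (λ i → others (suc i) λ ())))
    where
    if-≤1 : ∀ x → (if x then 1 else 0) ≤ 1
    if-≤1 true  = ≤-refl
    if-≤1 false = z≤n
    none : ∀ {k} (c : Fin k → Bool) → (∀ i → c i ≡ false) → count c ≡ 0
    none {zero}  c _   = refl
    none {suc k} c all rewrite all zero = none (c ∘ suc) (all ∘ suc)
  count-single {suc k} b (suc i₀) others rewrite others zero (λ ()) =
    count-single (b ∘ suc) i₀ (λ i i≢i₀ → others (suc i) (i≢i₀ ∘ Fin.suc-injective))

  -- dist in Defs counts the levels below n G at which v is not yet reached from u, so it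
  -- agrees with any D satisfying the breadth-first recursion below.
  module ShortestPaths (G : Graph) (D : Fin (n G) → Fin (n G) → ℕ)
      (D-self : ∀ u → D u u ≡ 0)
      (D≡0⇒≡ : ∀ u v → D u v ≡ 0 → u ≡ v)
      (D-adj : ∀ u w v → adj G w v ≡ true → D u v ≤ suc (D u w))
      (D-pred : ∀ u v j → D u v ≡ suc j → ∃[ w ] (D u w ≤ j × adj G w v ≡ true))
      (D≤n : ∀ u v → D u v ≤ n G) where

    reach⇒D≤ : ∀ k u v → T (reach G k u v) → D u v ≤ k
    reach⇒D≤ zero    u v r rewrite toWitness r | D-self v = z≤n
    reach⇒D≤ (suc k) u v r with Equivalence.to T-∨ r
    ... | inj₁ r′ = m≤n⇒m≤1+n (reach⇒D≤ k u v r′)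
    ... | inj₂ r′ with satisfied (any⁻ _ (allFin (n G)) r′)
    ... | w , rw with Equivalence.to T-∧ rw
    ... | r″ , w~v = ≤-trans (D-adj u w v (Equivalence.to T-≡ w~v)) (s≤s (reach⇒D≤ k u w r″))

    D≤⇒reach : ∀ k u v → D u v ≤ k → T (reach G k u v)
    D≤⇒reach zero    u v le rewrite D≡0⇒≡ u v (n≤0⇒n≡0 le) = fromWitness refl
    D≤⇒reach (suc k) u v le with m≤n⇒m<n∨m≡n le
    ... | inj₁ (s≤s lt) = Equivalence.from T-∨ (inj₁ (D≤⇒reach k u v lt))
    ... | inj₂ eq with D-pred u v k eq
    ... | w , Duw≤k , w~v = Equivalence.from T-∨ (inj₂ (any⁺ _ (lose (∈-allFin w)
            (Equivalence.from T-∧ (D≤⇒reach k u w Duw≤k , Equivalence.from T-≡ w~v)))))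

    connected : Connected G
    connected u v = D u v , Equivalence.to T-≡ (D≤⇒reach (D u v) u v ≤-refl)

    private
      step : Fin (n G) → Fin (n G) → ℕ → ℕ → ℕ
      step u v k acc = if reach G k u v then acc else suc acc

      foldr-step : ∀ u v xs a → foldr (step u v) a xs ≡ foldr (step u v) 0 xs + a
      foldr-step u v []       a = refl
      foldr-step u v (k ∷ xs) a rewrite foldr-step u v xs a with reach G k u v
      ... | true  = refl
      ... | false = refl

      misses : Fin (n G) → Fin (n G) → ℕ → ℕ
      misses u v N = foldr (step u v) 0 (upTo N)

      misses-suc : ∀ u v N → misses u v (suc N) ≡ misses u v N + step u v N 0
      misses-suc u v N = begin
        foldr (step u v) 0 (upTo (suc N))   ≡⟨ cong (foldr (step u v) 0) (sym (upTo-∷ʳ N)) ⟩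
        foldr (step u v) 0 (upTo N ∷ʳ N)    ≡⟨ foldr-∷ʳ (step u v) 0 N (upTo N) ⟩
        foldr (step u v) (step u v N 0) (upTo N) ≡⟨ foldr-step u v (upTo N) _ ⟩
        misses u v N + step u v N 0         ∎
        where open ≡-Reasoning

      misses-below : ∀ u v N → N ≤ D u v → misses u v N ≡ N
      misses-below u v zero    _  = refl
      misses-below u v (suc N) le rewrite misses-suc u v N | misses-below u v N (<⇒≤ le)
        with reach G N u v in eq
      ... | true  = ⊥-elim (<⇒≱ le (reach⇒D≤ N u v (Equivalence.from T-≡ eq)))
      ... | false = +-comm N 1

      misses-above : ∀ u v N → D u v ≤ N → misses u v N ≡ D u v
      misses-above u v zero    le = sym (n≤0⇒n≡0 le)
      misses-above u v (suc N) le with m≤n⇒m<n∨m≡n le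
      ... | inj₁ (s≤s lt) rewrite misses-suc u v N | misses-above u v N lt
                                | Equivalence.to T-≡ (D≤⇒reach N u v lt) = +-identityʳ _
      ... | inj₂ eq = trans (misses-below u v (suc N) (≤-reflexive (sym eq))) (sym eq)

    dist≡D : ∀ u v → dist G u v ≡ D u v
    dist≡D u v = misses-above u v (n G) (D≤n u v)

  ∣p∪q∣≤∣p∣+∣q∣ : ∀ {k} (p q : Subset k) → ∣ p ∪ q ∣ ≤ ∣ p ∣ + ∣ q ∣
  ∣p∪q∣≤∣p∣+∣q∣ []            []            = z≤n
  ∣p∪q∣≤∣p∣+∣q∣ (inside ∷ p)  (x ∷ q)       =
    s≤s (≤-trans (∣p∪q∣≤∣p∣+∣q∣ p q) (+-monoʳ-≤ ∣ p ∣ (∣p∣≤∣x∷p∣ x q)))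
  ∣p∪q∣≤∣p∣+∣q∣ (outside ∷ p) (inside ∷ q)  =
    ≤-trans (s≤s (∣p∪q∣≤∣p∣+∣q∣ p q)) (≤-reflexive (sym (+-suc ∣ p ∣ ∣ q ∣)))
  ∣p∪q∣≤∣p∣+∣q∣ (outside ∷ p) (outside ∷ q) = ∣p∪q∣≤∣p∣+∣q∣ p q

  module _ (G : Graph) where

    inRe⇒≢ : ∀ e₁ e₂ v → inRe G e₁ e₂ v ≡ true → edgeDist G e₁ v ≢ edgeDist G e₂ v
    inRe⇒≢ e₁ e₂ v r eq rewrite Equivalence.to T-≡ (≡⇒≡ᵇ _ _ eq) with r
    ... | ()

    ≢⇒inRe : ∀ e₁ e₂ v → edgeDist G e₁ v ≢ edgeDist G e₂ v → inRe G e₁ e₂ v ≡ true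
    ≢⇒inRe e₁ e₂ v ne with edgeDist G e₁ v ≡ᵇ edgeDist G e₂ v in eq
    ... | true  = ⊥-elim (ne (≡ᵇ⇒≡ _ _ (Equivalence.from T-≡ eq)))
    ... | false = refl

    ≡⇒¬inRe : ∀ e₁ e₂ v → edgeDist G e₁ v ≡ edgeDist G e₂ v → inRe G e₁ e₂ v ≡ false
    ≡⇒¬inRe e₁ e₂ v eq rewrite Equivalence.to T-≡ (≡⇒≡ᵇ _ _ eq) = refl

    indicator-resolving : ∀ S → IsEdgeResolvingSet G S → IsEdgeResolvingFunction G (indicator S)
    indicator-resolving S resolves = bounds , covers
      where
      bounds : ∀ v → (0ℚ ≤ℚ indicator S v) × (indicator S v ≤ℚ 1ℚ)
      bounds v with lookup S v
      ... | true  = ℚ.nonNegative⁻¹ 1ℚ , ℚ.≤-refl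
      ... | false = ℚ.≤-refl , ℚ.nonNegative⁻¹ 1ℚ
      covers : ∀ e₁ e₂ → DistinctEdges G e₁ e₂ → 1ℚ ≤ℚ sumOver G (inRe G e₁ e₂) (indicator S)
      covers e₁ e₂ e₁≢e₂ with resolves e₁ e₂ e₁≢e₂
      ... | v , v∈S , ne = subst₂ _≤ℚ_ term-v (sym (sumOver≡∑ G (inRe G e₁ e₂) (indicator S)))
              (term≤∑ (λ w → select-nonNeg (inRe G e₁ e₂ w) (proj₁ (bounds w))) v)
        where
        term-v : select (inRe G e₁ e₂ v) (indicator S v) ≡ 1ℚ
        term-v rewrite ≢⇒inRe e₁ e₂ v ne | []=⇒lookup v∈S = refl

    total-indicator : ∀ S → total G (indicator S) ≡ ℕtoℚ ∣ S ∣
    total-indicator S = trans (sumOver≡∑ G (λ _ → true) (indicator S)) (∑-indicator S)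

    edim-from-bounds : ∀ k S → IsEdgeResolvingSet G S → ∣ S ∣ ≤ k →
      (∀ g → IsEdgeResolvingFunction G g → ℕtoℚ k ≤ℚ total G g) →
      IsEdim G k × IsEdimF G (ℕtoℚ k)
    edim-from-bounds k S resolves ∣S∣≤k lower =
      ((S , resolves , ∣S∣≡k) , minimal) , ((indicator S , indicator-resolving S resolves , total≡k) , lower)
      where
      minimal : ∀ S′ → IsEdgeResolvingSet G S′ → k ≤ ∣ S′ ∣
      minimal S′ resolves′ = ℕtoℚ-cancel-≤
        (subst (ℕtoℚ k ≤ℚ_) (total-indicator S′) (lower _ (indicator-resolving S′ resolves′)))
      ∣S∣≡k : ∣ S ∣ ≡ k
      ∣S∣≡k = ≤-antisym ∣S∣≤k (minimal S resolves)
      total≡k : total G (indicator S) ≡ ℕtoℚ k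
      total≡k = trans (total-indicator S) (cong ℕtoℚ ∣S∣≡k)

    resolving-by-profile : ∀ S →
      (∀ e₁ e₂ → (∀ v → v ∈ S → edgeDist G e₁ v ≡ edgeDist G e₂ v) → endpoints G e₁ ≡ endpoints G e₂) →
      IsEdgeResolvingSet G S
    resolving-by-profile S determines e₁ e₂ e₁≢e₂
      with Fin.¬∀⟶∃¬ (n G) Agrees agrees? (e₁≢e₂ ∘ determines e₁ e₂)
      where
      Agrees : Fin (n G) → Set
      Agrees v = v ∈ S → edgeDist G e₁ v ≡ edgeDist G e₂ v
      agrees? : ∀ v → Dec (Agrees v)
      agrees? v with v ∈? S | edgeDist G e₁ v ≟ edgeDist G e₂ v
      ... | no v∉S | _      = yes (λ v∈S → ⊥-elim (v∉S v∈S))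
      ... | yes _  | yes eq = yes (λ _ → eq)
      ... | yes v∈S | no ne = no (λ agree → ne (agree v∈S))
    ... | v , disagrees with v ∈? S
    ...   | yes v∈S = v , v∈S , λ eq → disagrees (λ _ → eq)
    ...   | no v∉S  = ⊥-elim (disagrees (λ v∈S → ⊥-elim (v∉S v∈S)))

    packing-bound : ∀ {k} (pair : Fin k → Edge G × Edge G) → (∀ i → uncurry (DistinctEdges G) (pair i)) →
      ∀ t → (∀ v → count (λ i → uncurry (inRe G) (pair i) v) ≤ t) →
      ∀ g → IsEdgeResolvingFunction G g → ℕtoℚ k ≤ℚ ℕtoℚ t *ℚ total G g
    packing-bound {k} pair distinct t multiplicity g (bounds , covers) = begin
      ℕtoℚ k                                               ≡⟨ sym (∑-ones k) ⟩
      ∑[ i < k ] 1ℚ                                        ≤⟨ ∑-mono-≤ covered ⟩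
      ∑[ i < k ] ∑[ v < n G ] select (R i v) (g v)
        ≡⟨ ∑-comm (λ i v → select (R i v) (g v)) ⟩
      ∑[ v < n G ] ∑[ i < k ] select (R i v) (g v)
        ≡⟨ sum-cong-≗ (λ v → ∑-select≡count* (λ i → R i v) (g v)) ⟩
      ∑[ v < n G ] (ℕtoℚ (count (λ i → R i v)) *ℚ g v)
        ≤⟨ ∑-mono-≤ (λ v → ℚ.*-monoʳ-≤-nonNeg (g v) {{nonNegative (proj₁ (bounds v))}}
                                              (ℕtoℚ-mono-≤ (multiplicity v))) ⟩
      ∑[ v < n G ] (ℕtoℚ t *ℚ g v)
        ≡⟨ sym (*-distribˡ-sum (ℕtoℚ t) g) ⟩
      ℕtoℚ t *ℚ sum g
        ≡⟨ cong (ℕtoℚ t *ℚ_) (sym (sumOver≡∑ G _ g)) ⟩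
      ℕtoℚ t *ℚ total G g
        ∎
      where
      open ℚ.≤-Reasoning
      R : Fin k → Fin (n G) → Bool
      R i = uncurry (inRe G) (pair i)
      covered : ∀ i → 1ℚ ≤ℚ ∑[ v < n G ] select (R i v) (g v)
      covered i = subst (1ℚ ≤ℚ_) (sumOver≡∑ G (R i) g) (covers (proj₁ (pair i)) (proj₂ (pair i)) (distinct i))

    edge : ∀ a b → a ≢ b → adj G a b ≡ true → Edge G
    edge a b a≢b a~b with Fin.<-cmp a b
    ... | tri< a<b _ _ = a , b , a<b , a~b
    ... | tri≈ _ a≡b _ = ⊥-elim (a≢b a≡b)
    ... | tri> _ _ b<a = b , a , b<a , trans (Graph.sym G b a) a~b

    edgeDist-edge : ∀ a b a≢b a~b v → edgeDist G (edge a b a≢b a~b) v ≡ dist G a v ⊓ dist G b v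
    edgeDist-edge a b a≢b a~b v with Fin.<-cmp a b
    ... | tri< _ _ _   = refl
    ... | tri≈ _ a≡b _ = ⊥-elim (a≢b a≡b)
    ... | tri> _ _ _   = ⊓-comm (dist G b v) (dist G a v)

    edgeDist-edge-near : ∀ a b a≢b a~b v {x} → dist G a v ≡ x → dist G b v ≡ suc x →
      edgeDist G (edge a b a≢b a~b) v ≡ x
    edgeDist-edge-near a b a≢b a~b v {x} da db =
      trans (edgeDist-edge a b a≢b a~b v) (trans (cong₂ _⊓_ da db) (m≤n⇒m⊓n≡m (n≤1+n x)))

    edge-distinct : ∀ a b c a≢b a~b a≢c a~c → b ≢ c → DistinctEdges G (edge a b a≢b a~b) (edge a c a≢c a~c)
    edge-distinct a b c a≢b a~b a≢c a~c b≢c with Fin.<-cmp a b | Fin.<-cmp a c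
    ... | tri≈ _ a≡b _ | _            = ⊥-elim (a≢b a≡b)
    ... | _            | tri≈ _ a≡c _ = ⊥-elim (a≢c a≡c)
    ... | tri< _ _ _   | tri< _ _ _   = λ eq → b≢c (cong proj₂ eq)
    ... | tri< _ _ _   | tri> _ _ _   = λ eq → a≢b (sym (cong proj₂ eq))
    ... | tri> _ _ _   | tri< _ _ _   = λ eq → a≢b (sym (cong proj₁ eq))
    ... | tri> _ _ _   | tri> _ _ _   = λ eq → b≢c (cong proj₁ eq)

  -- v : Fin (m * 3) is the cell in column col v and row row v, toℕ v = 3 * col v + row v.
  -- The coordinates are abstract: unfolding remQuot makes terms blow up.
  module Coordinates (m : ℕ) where

    V : Set
    V = Fin (m * 3)

    abstract
      col : V → ℕ
      col v = toℕ (proj₁ (remQuot {m} 3 v))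

      row : V → ℕ
      row v = toℕ (proj₂ (remQuot {m} 3 v))

      col< : ∀ v → col v < m
      col< v = Fin.toℕ<n _

      row< : ∀ v → row v < 3
      row< v = Fin.toℕ<n _

      col-cell : ∀ (c : Fin m) (r : Fin 3) → col (combine c r) ≡ toℕ c
      col-cell c r = cong (toℕ ∘ proj₁) (Fin.remQuot-combine c r)

      row-cell : ∀ (c : Fin m) (r : Fin 3) → row (combine c r) ≡ toℕ r
      row-cell c r = cong (toℕ ∘ proj₂) (Fin.remQuot-combine c r)

      coord-injective : ∀ u v → col u ≡ col v → row u ≡ row v → u ≡ v
      coord-injective u v cu≡cv ru≡rv = begin
        u                                                ≡⟨ sym (Fin.combine-remQuot {m} 3 u) ⟩
        combine (proj₁ (remQuot {m} 3 u)) (proj₂ (remQuot {m} 3 u))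
          ≡⟨ cong₂ combine (Fin.toℕ-injective cu≡cv) (Fin.toℕ-injective ru≡rv) ⟩
        combine (proj₁ (remQuot {m} 3 v)) (proj₂ (remQuot {m} 3 v)) ≡⟨ Fin.combine-remQuot {m} 3 v ⟩
        v                                                ∎
        where open ≡-Reasoning

      toℕ≡3*col+row : ∀ v → toℕ v ≡ 3 * col v + row v
      toℕ≡3*col+row v = trans (cong toℕ (sym (Fin.combine-remQuot {m} 3 v)))
                              (Fin.toℕ-combine (proj₁ (remQuot {m} 3 v)) (proj₂ (remQuot {m} 3 v)))

      vertex : (c r : ℕ) → c < m → r < 3 → V
      vertex c r c<m r<3 = combine (fromℕ< c<m) (fromℕ< r<3)

      col-vertex : ∀ c r c<m r<3 → col (vertex c r c<m r<3) ≡ c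
      col-vertex c r c<m r<3 = trans (col-cell _ _) (Fin.toℕ-fromℕ< c<m)

      row-vertex : ∀ c r c<m r<3 → row (vertex c r c<m r<3) ≡ r
      row-vertex c r c<m r<3 = trans (row-cell _ _) (Fin.toℕ-fromℕ< r<3)

    cell : Fin m → Fin 3 → V
    cell = combine

    vertex-injective : ∀ {c r c′ r′ c<m r<3 c′<m r′<3} →
      vertex c r c<m r<3 ≡ vertex c′ r′ c′<m r′<3 → c ≡ c′ × r ≡ r′
    vertex-injective {c} {r} {c′} {r′} {c<m} {r<3} {c′<m} {r′<3} eq =
      trans (sym (col-vertex c r c<m r<3)) (trans (cong col eq) (col-vertex c′ r′ c′<m r′<3)) ,
      trans (sym (row-vertex c r c<m r<3)) (trans (cong row eq) (row-vertex c′ r′ c′<m r′<3))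

    left-of⇒< : ∀ x y → row y ≡ row x → col y ≡ suc (col x) → toℕ x < toℕ y
    left-of⇒< x y ry≡rx cy≡1+cx = begin-strict
      toℕ x                   ≡⟨ toℕ≡3*col+row x ⟩
      3 * col x + row x       <⟨ +-monoˡ-< (row x) (*-monoʳ-< 3 (n<1+n (col x))) ⟩
      3 * suc (col x) + row x ≡⟨ cong₂ (λ c r → 3 * c + r) cy≡1+cx ry≡rx ⟨
      3 * col y + row y       ≡⟨ toℕ≡3*col+row y ⟨
      toℕ y                   ∎
      where open ≤-Reasoning

    above⇒< : ∀ x y → col y ≡ col x → row y ≡ suc (row x) → toℕ x < toℕ y
    above⇒< x y cy≡cx ry≡1+rx = begin-strict
      toℕ x                   ≡⟨ toℕ≡3*col+row x ⟩
      3 * col x + row x       <⟨ +-monoʳ-< (3 * col x) (n<1+n (row x)) ⟩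
      3 * col x + suc (row x) ≡⟨ cong₂ (λ c r → 3 * c + r) cy≡cx ry≡1+rx ⟨
      3 * col y + row y       ≡⟨ toℕ≡3*col+row y ⟨
      toℕ y                   ∎
      where open ≤-Reasoning

  module CoordinateGraph (m : ℕ) (Step : ℕ → ℕ → ℕ → ℕ → Set)
      (step? : ∀ c r c′ r′ → Dec (Step c r c′ r′))
      (step-sym : ∀ {c r c′ r′} → Step c r c′ r′ → Step c′ r′ c r)
      (step-irrefl : ∀ {c r} → ¬ Step c r c r) where

    open Coordinates m public

    graph : Graph
    graph = record
      { n      = m * 3
      ; adj    = λ u v → does (step? (col u) (row u) (col v) (row v))
      ; sym    = λ u v → symmetric (col u) (row u) (col v) (row v)
      ; irrefl = λ u → irreflexive (col u) (row u)
      }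
      where
      symmetric : ∀ c r c′ r′ → does (step? c r c′ r′) ≡ does (step? c′ r′ c r)
      symmetric c r c′ r′ with step? c r c′ r′ | step? c′ r′ c r
      ... | yes _ | yes _ = refl
      ... | yes s | no ¬s = ⊥-elim (¬s (step-sym s))
      ... | no ¬s | yes s = ⊥-elim (¬s (step-sym s))
      ... | no _  | no _  = refl
      irreflexive : ∀ c r → does (step? c r c r) ≡ false
      irreflexive c r with step? c r c r
      ... | yes s = ⊥-elim (step-irrefl s)
      ... | no _  = refl

    adj⇒step : ∀ u v → adj graph u v ≡ true → Step (col u) (row u) (col v) (row v)
    adj⇒step u v u~v with step? (col u) (row u) (col v) (row v)
    ... | yes s = s

    step⇒adj : ∀ u v → Step (col u) (row u) (col v) (row v) → adj graph u v ≡ true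
    step⇒adj u v = dec-true (step? (col u) (row u) (col v) (row v))

    step⇒adj-vertex : ∀ {c r c′ r′} c<m r<3 c′<m r′<3 → Step c r c′ r′ →
      adj graph (vertex c r c<m r<3) (vertex c′ r′ c′<m r′<3) ≡ true
    step⇒adj-vertex {c} {r} {c′} {r′} c<m r<3 c′<m r′<3 s = step⇒adj _ _
      (subst₂ (λ (x y : ℕ × ℕ) → Step (proj₁ x) (proj₂ x) (proj₁ y) (proj₂ y))
              (sym (cong₂ _,_ (col-vertex c r c<m r<3) (row-vertex c r c<m r<3)))
              (sym (cong₂ _,_ (col-vertex c′ r′ c′<m r′<3) (row-vertex c′ r′ c′<m r′<3))) s)

  ∣m-n∣≡1⇒ : ∀ a b → ∣ a - b ∣ ≡ 1 → b ≡ suc a ⊎ a ≡ suc b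
  ∣m-n∣≡1⇒ zero          (suc zero) _ = inj₁ refl
  ∣m-n∣≡1⇒ (suc zero)    zero       _ = inj₂ refl
  ∣m-n∣≡1⇒ (suc a)       (suc b)    d with ∣m-n∣≡1⇒ a b d
  ... | inj₁ b≡1+a = inj₁ (cong suc b≡1+a)
  ... | inj₂ a≡1+b = inj₂ (cong suc a≡1+b)

  ∣n-1+n∣≡1 : ∀ a → ∣ a - suc a ∣ ≡ 1
  ∣n-1+n∣≡1 zero    = refl
  ∣n-1+n∣≡1 (suc a) = ∣n-1+n∣≡1 a

  ∣1+n-n∣≡1 : ∀ a → ∣ suc a - a ∣ ≡ 1
  ∣1+n-n∣≡1 a = trans (∣-∣-comm (suc a) a) (∣n-1+n∣≡1 a)

  ∣m-1+n∣≡1+∣m-n∣ : ∀ {a b} → a ≤ b → ∣ a - suc b ∣ ≡ suc ∣ a - b ∣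
  ∣m-1+n∣≡1+∣m-n∣ {zero}  {b}     _         = refl
  ∣m-1+n∣≡1+∣m-n∣ {suc a} {suc b} (s≤s a≤b) = ∣m-1+n∣≡1+∣m-n∣ a≤b

  ∣m-n∣+m≡n : ∀ {a b} → a ≤ b → ∣ a - b ∣ + a ≡ b
  ∣m-n∣+m≡n a≤b = trans (cong (_+ _) (m≤n⇒∣m-n∣≡n∸m a≤b)) (m∸n+n≡m a≤b)

  ∣m-n∣<bound : ∀ {a b B} → a < B → b < B → ∣ a - b ∣ < B
  ∣m-n∣<bound {a} {b} a<B b<B = ≤-<-trans (∣m-n∣≤m⊔n a b) (⊔-lub a<B b<B)

  step-toward : ∀ a b → a ≢ b →
    ∃[ b′ ] (suc ∣ a - b′ ∣ ≡ ∣ a - b ∣ × ∣ b′ - b ∣ ≡ 1 × (b′ ≤ a ⊎ b′ ≤ b))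
  step-toward zero    zero    a≢b = ⊥-elim (a≢b refl)
  step-toward zero    (suc b) _   = b , refl , ∣n-1+n∣≡1 b , inj₂ (n≤1+n b)
  step-toward (suc a) zero    _   = 1 , cong suc (∣-∣-identityʳ a) , refl , inj₁ (s≤s z≤n)
  step-toward (suc a) (suc b) a≢b with step-toward a b (a≢b ∘ cong suc)
  ... | b′ , closer , adjacent , inj₁ b′≤a = suc b′ , closer , adjacent , inj₁ (s≤s b′≤a)
  ... | b′ , closer , adjacent , inj₂ b′≤b = suc b′ , closer , adjacent , inj₂ (s≤s b′≤b)

  double-plus-bit-injective : ∀ c c′ h h′ → h ≤ 1 → h′ ≤ 1 →
    c + c + h ≡ c′ + c′ + h′ → h ≡ h′ × c ≡ c′
  double-plus-bit-injective zero zero h h′ _ _ eq = eq , refl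
  double-plus-bit-injective zero (suc c′) h h′ h≤1 _ eq
    rewrite +-suc c′ c′ | eq with s≤s () ← h≤1
  double-plus-bit-injective (suc c) zero h h′ _ h′≤1 eq
    rewrite +-suc c c | sym eq with s≤s () ← h′≤1
  double-plus-bit-injective (suc c) (suc c′) h h′ h≤1 h′≤1 eq rewrite +-suc c c | +-suc c′ c′
    with double-plus-bit-injective c c′ h h′ h≤1 h′≤1 (suc-injective (suc-injective eq))
  ... | h≡h′ , c≡c′ = h≡h′ , cong suc c≡c′

  -- An edge with lower end in row r, column c, vertical (h = 0) or horizontal (h = 1), is
  -- at distance r + c from the corner (0, 0) and at distance b, b + c + h = r + K′, from (0, K′).
  corner-profile-injective : ∀ r c h r′ c′ h′ b K′ → h ≤ 1 → h′ ≤ 1 →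
    r + c ≡ r′ + c′ → b + c + h ≡ r + K′ → b + c′ + h′ ≡ r′ + K′ → h ≡ h′ × c ≡ c′ × r ≡ r′
  corner-profile-injective r c h r′ c′ h′ b K′ h≤1 h′≤1 d₀ dK dK′
    with double-plus-bit-injective c c′ h h′ h≤1 h′≤1 doubled
    where
    open ≡-Reasoning
    regroup : ∀ b c h r → b + (c + h + r) ≡ (b + c + h) + r
    regroup = solve-∀
    swap : ∀ r K r′ → r + K + r′ ≡ r′ + K + r
    swap = solve-∀
    shifted : c + h + r′ ≡ c′ + h′ + r
    shifted = +-cancelˡ-≡ b _ _ (begin
      b + (c + h + r′)    ≡⟨ regroup b c h r′ ⟩
      (b + c + h) + r′    ≡⟨ cong (_+ r′) dK ⟩
      r + K′ + r′         ≡⟨ swap r K′ r′ ⟩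
      r′ + K′ + r         ≡⟨ cong (_+ r) (sym dK′) ⟩
      (b + c′ + h′) + r   ≡⟨ regroup b c′ h′ r ⟨
      b + (c′ + h′ + r)   ∎)
    pull : ∀ c h r → c + c + h + r ≡ (c + h + r) + c
    pull = solve-∀
    push : ∀ c h r c₀ → (c + h + r) + c₀ ≡ c + h + (r + c₀)
    push = solve-∀
    doubled : c + c + h ≡ c′ + c′ + h′
    doubled = +-cancelʳ-≡ r′ _ _ (begin
      c + c + h + r′      ≡⟨ pull c h r′ ⟩
      (c + h + r′) + c    ≡⟨ cong (_+ c) shifted ⟩
      (c′ + h′ + r) + c   ≡⟨ push c′ h′ r c ⟩
      c′ + h′ + (r + c)   ≡⟨ cong (λ z → c′ + h′ + z) d₀ ⟩
      c′ + h′ + (r′ + c′) ≡⟨ push c′ h′ r′ c′ ⟨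
      (c′ + h′ + r′) + c′ ≡⟨ pull c′ h′ r′ ⟨
      c′ + c′ + h′ + r′   ∎)
  ... | h≡h′ , refl = h≡h′ , refl , +-cancelʳ-≡ c _ _ d₀

  -- Only vertices on exactly one of row r₀ and column c₀ distinguish the two edges at the
  -- corner (r₀, c₀); for the four corners this is cross-pattern, true at most twice.
  corner-cross : ∀ r r₀ r₁ c c₀ c₁ →
    (r ≢ r₀ → suc ∣ r₁ - r ∣ ≡ ∣ r₀ - r ∣) → (c ≢ c₀ → suc ∣ c₁ - c ∣ ≡ ∣ c₀ - c ∣) →
    (∣ r₀ - r ∣ + ∣ c₀ - c ∣) ⊓ (∣ r₁ - r ∣ + ∣ c₀ - c ∣) ≢
      (∣ r₀ - r ∣ + ∣ c₀ - c ∣) ⊓ (∣ r₀ - r ∣ + ∣ c₁ - c ∣) →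
    (⌊ r ≟ r₀ ⌋ xor ⌊ c ≟ c₀ ⌋) ≡ true
  corner-cross r r₀ r₁ c c₀ c₁ toward-r₁ toward-c₁ differ with r ≟ r₀ | c ≟ c₀
  ... | yes refl | yes refl rewrite ∣n-n∣≡0 r | ∣n-n∣≡0 c = ⊥-elim (differ refl)
  ... | yes _    | no _     = refl
  ... | no _     | yes _    = refl
  ... | no r≢r₀  | no c≢c₀  rewrite sym (toward-r₁ r≢r₀) | sym (toward-c₁ c≢c₀) = ⊥-elim (differ (begin
    (suc ρ + suc γ) ⊓ (ρ + suc γ)   ≡⟨ m≥n⇒m⊓n≡n (n≤1+n _) ⟩
    ρ + suc γ                       ≡⟨ +-suc ρ γ ⟩
    suc ρ + γ                       ≡⟨ m≥n⇒m⊓n≡n (+-monoʳ-≤ (suc ρ) (n≤1+n γ)) ⟨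
    (suc ρ + suc γ) ⊓ (suc ρ + γ)   ∎))
    where
    open ≡-Reasoning
    ρ γ : ℕ
    ρ = ∣ r₁ - r ∣
    γ = ∣ c₁ - c ∣

  cross-pattern : Bool → Bool → Bool → Bool → Fin 4 → Bool
  cross-pattern a a′ b b′ zero                   = a xor b
  cross-pattern a a′ b b′ (suc zero)             = a xor b′
  cross-pattern a a′ b b′ (suc (suc zero))       = a′ xor b
  cross-pattern a a′ b b′ (suc (suc (suc zero))) = a′ xor b′

  count-cross-pattern≤2 : ∀ a a′ b b′ → T (not (a ∧ a′)) → T (not (b ∧ b′)) →
    count (cross-pattern a a′ b b′) ≤ 2
  count-cross-pattern≤2 true  true  _     _     ()
  count-cross-pattern≤2 _     _     true  true  _  ()
  count-cross-pattern≤2 true  false true  false _  _ = ≤ᵇ⇒≤ _ 2 _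
  count-cross-pattern≤2 true  false false true  _  _ = ≤ᵇ⇒≤ _ 2 _
  count-cross-pattern≤2 true  false false false _  _ = ≤ᵇ⇒≤ _ 2 _
  count-cross-pattern≤2 false true  true  false _  _ = ≤ᵇ⇒≤ _ 2 _
  count-cross-pattern≤2 false true  false true  _  _ = ≤ᵇ⇒≤ _ 2 _
  count-cross-pattern≤2 false true  false false _  _ = ≤ᵇ⇒≤ _ 2 _
  count-cross-pattern≤2 false false true  false _  _ = ≤ᵇ⇒≤ _ 2 _
  count-cross-pattern≤2 false false false true  _  _ = ≤ᵇ⇒≤ _ 2 _
  count-cross-pattern≤2 false false false false _  _ = ≤ᵇ⇒≤ _ 2 _

  ≟-exclusive : ∀ x {p q} → p ≢ q → T (not (⌊ x ≟ p ⌋ ∧ ⌊ x ≟ q ⌋))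
  ≟-exclusive x {p} {q} p≢q with x ≟ p | x ≟ q
  ... | yes refl | yes refl = p≢q refl
  ... | yes _    | no _     = _
  ... | no _     | _        = _

  1+∣1-n∣≡∣0-n∣ : ∀ x → x ≢ 0 → suc ∣ 1 - x ∣ ≡ ∣ 0 - x ∣
  1+∣1-n∣≡∣0-n∣ zero    x≢0 = ⊥-elim (x≢0 refl)
  1+∣1-n∣≡∣0-n∣ (suc x) _   = refl

  1+∣m-n∣≡∣1+m-n∣ : ∀ B x → x ≤ suc B → x ≢ suc B → suc ∣ B - x ∣ ≡ ∣ suc B - x ∣
  1+∣m-n∣≡∣1+m-n∣ B x x≤1+B x≢1+B = begin
    suc ∣ B - x ∣   ≡⟨ cong suc (∣-∣-comm B x) ⟩
    suc ∣ x - B ∣   ≡⟨ ∣m-1+n∣≡1+∣m-n∣ (≤-pred (≤∧≢⇒< x≤1+B x≢1+B)) ⟨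
    ∣ x - suc B ∣   ≡⟨ ∣-∣-comm x (suc B) ⟩
    ∣ suc B - x ∣   ∎
    where open ≡-Reasoning

  GridStep : ℕ → ℕ → ℕ → ℕ → Set
  GridStep c r c′ r′ = (r ≡ r′ × ∣ c - c′ ∣ ≡ 1) ⊎ (c ≡ c′ × ∣ r - r′ ∣ ≡ 1)

  gridStep? : ∀ c r c′ r′ → Dec (GridStep c r c′ r′)
  gridStep? c r c′ r′ = (r ≟ r′ ×-dec ∣ c - c′ ∣ ≟ 1) ⊎-dec (c ≟ c′ ×-dec ∣ r - r′ ∣ ≟ 1)

  gridStep-sym : ∀ {c r c′ r′} → GridStep c r c′ r′ → GridStep c′ r′ c r
  gridStep-sym {c} {r} {c′} {r′} (inj₁ (r≡r′ , d)) = inj₁ (sym r≡r′ , trans (∣-∣-comm c′ c) d)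
  gridStep-sym {c} {r} {c′} {r′} (inj₂ (c≡c′ , d)) = inj₂ (sym c≡c′ , trans (∣-∣-comm r′ r) d)

  gridStep-irrefl : ∀ {c r} → ¬ GridStep c r c r
  gridStep-irrefl {c} {r} (inj₁ (_ , d)) with () ← trans (sym (∣n-n∣≡0 c)) d
  gridStep-irrefl {c} {r} (inj₂ (_ , d)) with () ← trans (sym (∣n-n∣≡0 r)) d

  module Grid (K : ℕ) where

    m : ℕ
    m = suc (suc K)

    open CoordinateGraph m GridStep gridStep? gridStep-sym gridStep-irrefl public

    manhattan : V → V → ℕ
    manhattan u v = ∣ row u - row v ∣ + ∣ col u - col v ∣

    manhattan-self : ∀ u → manhattan u u ≡ 0
    manhattan-self u rewrite ∣n-n∣≡0 (row u) | ∣n-n∣≡0 (col u) = refl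

    manhattan≡0⇒≡ : ∀ u v → manhattan u v ≡ 0 → u ≡ v
    manhattan≡0⇒≡ u v d≡0 = coord-injective u v
      (∣m-n∣≡0⇒m≡n (m+n≡0⇒n≡0 ∣ row u - row v ∣ d≡0)) (∣m-n∣≡0⇒m≡n (m+n≡0⇒m≡0 _ d≡0))

    manhattan-adj : ∀ w v → adj graph w v ≡ true → manhattan w v ≡ 1
    manhattan-adj w v w~v with adj⇒step w v w~v
    ... | inj₁ (r≡r′ , d) rewrite r≡r′ | ∣n-n∣≡0 (row v) = d
    ... | inj₂ (c≡c′ , d) rewrite c≡c′ | ∣n-n∣≡0 (col v) = trans (+-identityʳ _) d

    manhattan-step : ∀ u w v → adj graph w v ≡ true → manhattan u v ≤ suc (manhattan u w)
    manhattan-step u w v w~v = begin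
      manhattan u v                                   ≤⟨ +-mono-≤ (∣-∣-triangle (row u) (row w) (row v))
                                                                  (∣-∣-triangle (col u) (col w) (col v)) ⟩
      (∣ row u - row w ∣ + ∣ row w - row v ∣) + (∣ col u - col w ∣ + ∣ col w - col v ∣)
                                                      ≡⟨ interchange ∣ row u - row w ∣ _ _ _ ⟩
      manhattan u w + manhattan w v                   ≡⟨ cong (manhattan u w +_) (manhattan-adj w v w~v) ⟩
      manhattan u w + 1                               ≡⟨ +-comm _ 1 ⟩
      suc (manhattan u w)                             ∎
      where open ≤-Reasoning

    manhattan-pred : ∀ u v j → manhattan u v ≡ suc j → ∃[ w ] (manhattan u w ≤ j × adj graph w v ≡ true)
    manhattan-pred u v j d≡1+j with col u ≟ col v
    ... | no cu≢cv with step-toward (col u) (col v) cu≢cv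
    ...   | c′ , closer , adjacent , between =
      w , ≤-reflexive Duw≡j , step⇒adj w v (inj₁ (rw , trans (cong (∣_- col v ∣) cw) adjacent))
      where
      c′<m : c′ < m
      c′<m = [ (λ c′≤cu → ≤-<-trans c′≤cu (col< u)) , (λ c′≤cv → ≤-<-trans c′≤cv (col< v)) ]′ between
      w : V
      w = vertex c′ (row v) c′<m (row< v)
      cw : col w ≡ c′
      cw = col-vertex c′ (row v) c′<m (row< v)
      rw : row w ≡ row v
      rw = row-vertex c′ (row v) c′<m (row< v)
      Duw≡j : manhattan u w ≡ j
      Duw≡j rewrite cw | rw =
        suc-injective (trans (sym (+-suc _ _)) (trans (cong (∣ row u - row v ∣ +_) closer) d≡1+j))
    manhattan-pred u v j d≡1+j | yes cu≡cv with step-toward (row u) (row v) ru≢rv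
      where
      ru≢rv : row u ≢ row v
      ru≢rv ru≡rv = 0≢1+n (trans (sym (manhattan-self u))
                           (subst (λ z → manhattan u z ≡ suc j) (sym (coord-injective u v cu≡cv ru≡rv)) d≡1+j))
    ...   | r′ , closer , adjacent , between =
      w , ≤-reflexive Duw≡j , step⇒adj w v (inj₂ (cw , trans (cong (∣_- row v ∣) rw) adjacent))
      where
      r′<3 : r′ < 3
      r′<3 = [ (λ r′≤ru → ≤-<-trans r′≤ru (row< u)) , (λ r′≤rv → ≤-<-trans r′≤rv (row< v)) ]′ between
      w : V
      w = vertex (col v) r′ (col< v) r′<3
      cw : col w ≡ col v
      cw = col-vertex (col v) r′ (col< v) r′<3
      rw : row w ≡ r′
      rw = row-vertex (col v) r′ (col< v) r′<3
      Duw≡j : manhattan u w ≡ j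
      Duw≡j rewrite cw | rw = suc-injective (trans (cong (_+ ∣ col u - col v ∣) closer) d≡1+j)

    manhattan≤n : ∀ u v → manhattan u v ≤ m * 3
    manhattan≤n u v = ≤-trans
      (+-mono-≤ (≤-pred (∣m-n∣<bound (row< u) (row< v))) (≤-pred (∣m-n∣<bound (col< u) (col< v))))
      (s≤s (s≤s (s≤s (≤-trans (m≤m*n K 3) (m≤n+m _ 3)))))

    open ShortestPaths graph manhattan manhattan-self manhattan≡0⇒≡ manhattan-step manhattan-pred manhattan≤n public

    data EdgeShape (x y : V) : ℕ → Set where
      vertical   : col y ≡ col x → row y ≡ suc (row x) → EdgeShape x y 0
      horizontal : row y ≡ row x → col y ≡ suc (col x) → EdgeShape x y 1

    shape≤1 : ∀ {x y h} → EdgeShape x y h → h ≤ 1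
    shape≤1 (vertical _ _)   = z≤n
    shape≤1 (horizontal _ _) = s≤s z≤n

    edge-shape : ∀ x y → toℕ x < toℕ y → adj graph x y ≡ true → ∃[ h ] EdgeShape x y h
    edge-shape x y x<y x~y with adj⇒step x y x~y
    ... | inj₁ (rx≡ry , d) with ∣m-n∣≡1⇒ (col x) (col y) d
    ...   | inj₁ cy≡1+cx = 1 , horizontal (sym rx≡ry) cy≡1+cx
    ...   | inj₂ cx≡1+cy = ⊥-elim (<-asym x<y (left-of⇒< y x rx≡ry cx≡1+cy))
    edge-shape x y x<y x~y | inj₂ (cx≡cy , d) with ∣m-n∣≡1⇒ (row x) (row y) d
    ...   | inj₁ ry≡1+rx = 0 , vertical (sym cx≡cy) ry≡1+rx
    ...   | inj₂ rx≡1+ry = ⊥-elim (<-asym x<y (above⇒< y x cx≡cy rx≡1+ry))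

    s₀ : V
    s₀ = vertex 0 0 (s≤s z≤n) (s≤s z≤n)

    sK : V
    sK = vertex (suc K) 0 ≤-refl (s≤s z≤n)

    manhattan-s₀ : ∀ x → manhattan x s₀ ≡ row x + col x
    manhattan-s₀ x rewrite col-vertex 0 0 (s≤s z≤n) (s≤s z≤n) | row-vertex 0 0 (s≤s z≤n) (s≤s z≤n)
                         | ∣-∣-identityʳ (row x) | ∣-∣-identityʳ (col x) = refl

    manhattan-sK : ∀ x → manhattan x sK ≡ row x + ∣ col x - suc K ∣
    manhattan-sK x rewrite col-vertex (suc K) 0 ≤-refl (s≤s z≤n) | row-vertex (suc K) 0 ≤-refl (s≤s z≤n)
                         | ∣-∣-identityʳ (row x) = refl

    edgeDist≡ : ∀ (e : Edge graph) v →
      edgeDist graph e v ≡ manhattan (proj₁ e) v ⊓ manhattan (proj₁ (proj₂ e)) v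
    edgeDist≡ (x , y , _) v = cong₂ _⊓_ (dist≡D x v) (dist≡D y v)

    corner-distances : ∀ {x y h} → EdgeShape x y h →
      (manhattan x s₀ ⊓ manhattan y s₀ ≡ row x + col x) ×
      (manhattan x sK ⊓ manhattan y sK + col x + h ≡ row x + suc K)
    corner-distances {x} {y} (vertical cy ry) = to-s₀ , to-sK
      where
      to-s₀ : manhattan x s₀ ⊓ manhattan y s₀ ≡ row x + col x
      to-s₀ rewrite manhattan-s₀ x | manhattan-s₀ y | cy | ry = m≤n⇒m⊓n≡m (n≤1+n _)
      to-sK : manhattan x sK ⊓ manhattan y sK + col x + 0 ≡ row x + suc K
      to-sK rewrite manhattan-sK x | manhattan-sK y | cy | ry
                  | m≤n⇒m⊓n≡m (n≤1+n (row x + ∣ col x - suc K ∣)) | +-identityʳ (row x + ∣ col x - suc K ∣ + col x)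
                  | +-assoc (row x) ∣ col x - suc K ∣ (col x) | ∣m-n∣+m≡n (≤-pred (col< x)) = refl
    corner-distances {x} {y} (horizontal ry cy) = to-s₀ , to-sK
      where
      to-s₀ : manhattan x s₀ ⊓ manhattan y s₀ ≡ row x + col x
      to-s₀ rewrite manhattan-s₀ x | manhattan-s₀ y | cy | ry = m≤n⇒m⊓n≡m (+-monoʳ-≤ (row x) (n≤1+n (col x)))
      cx≤K : col x ≤ K
      cx≤K = ≤-pred (≤-pred (subst (_< m) cy (col< y)))
      to-sK : manhattan x sK ⊓ manhattan y sK + col x + 1 ≡ row x + suc K
      to-sK rewrite manhattan-sK x | manhattan-sK y | cy | ry | ∣m-1+n∣≡1+∣m-n∣ cx≤K
                  | m≥n⇒m⊓n≡n (+-monoʳ-≤ (row x) (n≤1+n ∣ col x - K ∣)) = begin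
        row x + ∣ col x - K ∣ + col x + 1   ≡⟨ cong (_+ 1) (+-assoc (row x) _ (col x)) ⟩
        row x + (∣ col x - K ∣ + col x) + 1 ≡⟨ cong (λ z → row x + z + 1) (∣m-n∣+m≡n cx≤K) ⟩
        row x + K + 1                       ≡⟨ +-assoc (row x) K 1 ⟩
        row x + (K + 1)                     ≡⟨ cong (row x +_) (+-comm K 1) ⟩
        row x + suc K                       ∎
        where open ≡-Reasoning

    shape-determines : ∀ {x y x′ y′ h} → EdgeShape x y h → EdgeShape x′ y′ h →
      col x ≡ col x′ → row x ≡ row x′ → y ≡ y′
    shape-determines (vertical c₁ r₁) (vertical c₂ r₂) cx≡cx′ rx≡rx′ =
      coord-injective _ _ (trans c₁ (trans cx≡cx′ (sym c₂))) (trans r₁ (trans (cong suc rx≡rx′) (sym r₂)))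
    shape-determines (horizontal r₁ c₁) (horizontal r₂ c₂) cx≡cx′ rx≡rx′ =
      coord-injective _ _ (trans c₁ (trans (cong suc cx≡cx′) (sym c₂))) (trans r₁ (trans rx≡rx′ (sym r₂)))

    corners-determine : ∀ (e₁ e₂ : Edge graph) →
      edgeDist graph e₁ s₀ ≡ edgeDist graph e₂ s₀ → edgeDist graph e₁ sK ≡ edgeDist graph e₂ sK →
      endpoints graph e₁ ≡ endpoints graph e₂
    corners-determine e₁@(x , y , x<y , x~y) e₂@(x′ , y′ , x′<y′ , x′~y′) at-s₀ at-sK =
      same-edge (proj₂ (edge-shape x y x<y x~y)) (proj₂ (edge-shape x′ y′ x′<y′ x′~y′))
      where
      s₀-equal : manhattan x s₀ ⊓ manhattan y s₀ ≡ manhattan x′ s₀ ⊓ manhattan y′ s₀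
      s₀-equal = trans (sym (edgeDist≡ e₁ s₀)) (trans at-s₀ (edgeDist≡ e₂ s₀))
      sK-equal : manhattan x sK ⊓ manhattan y sK ≡ manhattan x′ sK ⊓ manhattan y′ sK
      sK-equal = trans (sym (edgeDist≡ e₁ sK)) (trans at-sK (edgeDist≡ e₂ sK))
      same-edge : ∀ {h h′} → EdgeShape x y h → EdgeShape x′ y′ h′ → (x , y) ≡ (x′ , y′)
      same-edge {h} {h′} shape shape′ = conclude
        (corner-profile-injective (row x) (col x) h (row x′) (col x′) h′ (manhattan x sK ⊓ manhattan y sK) (suc K)
           (shape≤1 shape) (shape≤1 shape′)
           (trans (sym (proj₁ (corner-distances shape))) (trans s₀-equal (proj₁ (corner-distances shape′))))
           (proj₂ (corner-distances shape))
           (subst (λ z → z + col x′ + h′ ≡ row x′ + suc K) (sym sK-equal) (proj₂ (corner-distances shape′))))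
        where
        conclude : h ≡ h′ × col x ≡ col x′ × row x ≡ row x′ → (x , y) ≡ (x′ , y′)
        conclude (refl , cx≡cx′ , rx≡rx′) =
          cong₂ _,_ (coord-injective x x′ cx≡cx′ rx≡rx′) (shape-determines shape shape′ cx≡cx′ rx≡rx′)

    corners : Subset (m * 3)
    corners = ⁅ s₀ ⁆ ∪ ⁅ sK ⁆

    corners-resolving : IsEdgeResolvingSet graph corners
    corners-resolving = resolving-by-profile graph corners λ e₁ e₂ agree →
      corners-determine e₁ e₂ (agree s₀ (x∈p∪q⁺ {p = ⁅ s₀ ⁆} {q = ⁅ sK ⁆} (inj₁ (x∈⁅x⁆ s₀))))
                              (agree sK (x∈p∪q⁺ {p = ⁅ s₀ ⁆} {q = ⁅ sK ⁆} (inj₂ (x∈⁅x⁆ sK))))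

    ∣corners∣≤2 : ∣ corners ∣ ≤ 2
    ∣corners∣≤2 = subst₂ (λ a b → ∣ corners ∣ ≤ a + b) (∣⁅x⁆∣≡1 s₀) (∣⁅x⁆∣≡1 sK)
                         (∣p∪q∣≤∣p∣+∣q∣ ⁅ s₀ ⁆ ⁅ sK ⁆)

    module CornerPair (c₀ r₀ c₁ r₁ : ℕ) (c₀<m : c₀ < m) (r₀<3 : r₀ < 3) (c₁<m : c₁ < m) (r₁<3 : r₁ < 3)
        (dr : ∣ r₀ - r₁ ∣ ≡ 1) (dc : ∣ c₀ - c₁ ∣ ≡ 1)
        (toward-r₁ : ∀ r → r < 3 → r ≢ r₀ → suc ∣ r₁ - r ∣ ≡ ∣ r₀ - r ∣)
        (toward-c₁ : ∀ c → c < m → c ≢ c₀ → suc ∣ c₁ - c ∣ ≡ ∣ c₀ - c ∣) where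

      corner below beside : V
      corner = vertex c₀ r₀ c₀<m r₀<3
      below  = vertex c₀ r₁ c₀<m r₁<3
      beside = vertex c₁ r₀ c₁<m r₀<3

      private
        ≢-of-∣-∣≡1 : ∀ {a b} → ∣ a - b ∣ ≡ 1 → a ≢ b
        ≢-of-∣-∣≡1 {a} d refl with () ← trans (sym (∣n-n∣≡0 a)) d

        dist-vertex : ∀ {c r} c<m r<3 v → dist graph (vertex c r c<m r<3) v ≡ ∣ r - row v ∣ + ∣ c - col v ∣
        dist-vertex {c} {r} c<m r<3 v = trans (dist≡D _ v)
          (cong₂ (λ p q → ∣ p - row v ∣ + ∣ q - col v ∣) (row-vertex c r c<m r<3) (col-vertex c r c<m r<3))

      corner≢below : corner ≢ below
      corner≢below = ≢-of-∣-∣≡1 dr ∘ proj₂ ∘ vertex-injective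

      corner≢beside : corner ≢ beside
      corner≢beside = ≢-of-∣-∣≡1 dc ∘ proj₁ ∘ vertex-injective

      below≢beside : below ≢ beside
      below≢beside = ≢-of-∣-∣≡1 dc ∘ proj₁ ∘ vertex-injective

      corner~below : adj graph corner below ≡ true
      corner~below = step⇒adj-vertex c₀<m r₀<3 c₀<m r₁<3 (inj₂ (refl , dr))

      corner~beside : adj graph corner beside ≡ true
      corner~beside = step⇒adj-vertex c₀<m r₀<3 c₁<m r₀<3 (inj₁ (refl , dc))

      edges : Edge graph × Edge graph
      edges = edge graph corner below corner≢below corner~below , edge graph corner beside corner≢beside corner~beside

      distinct : uncurry (DistinctEdges graph) edges
      distinct = edge-distinct graph corner below beside
        corner≢below corner~below corner≢beside corner~beside below≢beside

      inRe⇒cross : ∀ v → uncurry (inRe graph) edges v ≡ true → (⌊ row v ≟ r₀ ⌋ xor ⌊ col v ≟ c₀ ⌋) ≡ true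
      inRe⇒cross v r = corner-cross (row v) r₀ r₁ (col v) c₀ c₁
        (toward-r₁ (row v) (row< v)) (toward-c₁ (col v) (col< v))
        λ eq → inRe⇒≢ graph (proj₁ edges) (proj₂ edges) v r (begin
          edgeDist graph (proj₁ edges) v
            ≡⟨ edgeDist-edge graph corner below corner≢below corner~below v ⟩
          dist graph corner v ⊓ dist graph below v
            ≡⟨ cong₂ _⊓_ (dist-vertex c₀<m r₀<3 v) (dist-vertex c₀<m r₁<3 v) ⟩
          (∣ r₀ - row v ∣ + ∣ c₀ - col v ∣) ⊓ (∣ r₁ - row v ∣ + ∣ c₀ - col v ∣)
            ≡⟨ eq ⟩
          (∣ r₀ - row v ∣ + ∣ c₀ - col v ∣) ⊓ (∣ r₀ - row v ∣ + ∣ c₁ - col v ∣)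
            ≡⟨ cong₂ _⊓_ (dist-vertex c₀<m r₀<3 v) (dist-vertex c₁<m r₀<3 v) ⟨
          dist graph corner v ⊓ dist graph beside v
            ≡⟨ edgeDist-edge graph corner beside corner≢beside corner~beside v ⟨
          edgeDist graph (proj₂ edges) v
            ∎)
        where open ≡-Reasoning

    module TL = CornerPair 0       0 1 1 (s≤s z≤n) (s≤s z≤n) (s≤s (s≤s z≤n)) (s≤s (s≤s z≤n)) refl refl
                  (λ r _ → 1+∣1-n∣≡∣0-n∣ r) (λ c _ → 1+∣1-n∣≡∣0-n∣ c)
    module TR = CornerPair (suc K) 0 K 1 ≤-refl (s≤s z≤n) (m<n⇒m<1+n ≤-refl) (s≤s (s≤s z≤n)) refl (∣1+n-n∣≡1 K)
                  (λ r _ → 1+∣1-n∣≡∣0-n∣ r) (λ c c<m → 1+∣m-n∣≡∣1+m-n∣ K c (≤-pred c<m))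
    module BL = CornerPair 0       2 1 1 (s≤s z≤n) ≤-refl (s≤s (s≤s z≤n)) (s≤s (s≤s z≤n)) refl refl
                  (λ r r<3 → 1+∣m-n∣≡∣1+m-n∣ 1 r (≤-pred r<3)) (λ c _ → 1+∣1-n∣≡∣0-n∣ c)
    module BR = CornerPair (suc K) 2 K 1 ≤-refl ≤-refl (m<n⇒m<1+n ≤-refl) (s≤s (s≤s z≤n)) refl (∣1+n-n∣≡1 K)
                  (λ r r<3 → 1+∣m-n∣≡∣1+m-n∣ 1 r (≤-pred r<3)) (λ c c<m → 1+∣m-n∣≡∣1+m-n∣ K c (≤-pred c<m))

    corner-pair : Fin 4 → Edge graph × Edge graph
    corner-pair zero                   = TL.edges
    corner-pair (suc zero)             = TR.edges
    corner-pair (suc (suc zero))       = BL.edges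
    corner-pair (suc (suc (suc zero))) = BR.edges

    corner-pair-distinct : ∀ i → uncurry (DistinctEdges graph) (corner-pair i)
    corner-pair-distinct zero                   = TL.distinct
    corner-pair-distinct (suc zero)             = TR.distinct
    corner-pair-distinct (suc (suc zero))       = BL.distinct
    corner-pair-distinct (suc (suc (suc zero))) = BR.distinct

    corner-multiplicity : ∀ v → count (λ i → uncurry (inRe graph) (corner-pair i) v) ≤ 2
    corner-multiplicity v = ≤-trans (count-mono on-cross)
      (count-cross-pattern≤2 ⌊ row v ≟ 0 ⌋ ⌊ row v ≟ 2 ⌋ ⌊ col v ≟ 0 ⌋ ⌊ col v ≟ suc K ⌋
        (≟-exclusive (row v) {0} {2} λ ()) (≟-exclusive (col v) {0} {suc K} λ ()))
      where
      on-cross : ∀ i → uncurry (inRe graph) (corner-pair i) v ≡ true →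
        cross-pattern ⌊ row v ≟ 0 ⌋ ⌊ row v ≟ 2 ⌋ ⌊ col v ≟ 0 ⌋ ⌊ col v ≟ suc K ⌋ i ≡ true
      on-cross zero                   = TL.inRe⇒cross v
      on-cross (suc zero)             = TR.inRe⇒cross v
      on-cross (suc (suc zero))       = BL.inRe⇒cross v
      on-cross (suc (suc (suc zero))) = BR.inRe⇒cross v

    fractional-lower-bound : ∀ g → IsEdgeResolvingFunction graph g → ℕtoℚ 2 ≤ℚ total graph g
    -- ℕtoℚ 4 and ℕtoℚ 2 *ℚ ℕtoℚ 2 agree by computation.
    fractional-lower-bound g resolving = ℚ.*-cancelˡ-≤-pos (ℕtoℚ 2)
      (packing-bound graph corner-pair corner-pair-distinct 2 corner-multiplicity g resolving)

    edim≡2 : IsEdim graph 2 × IsEdimF graph (ℕtoℚ 2)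
    edim≡2 = edim-from-bounds graph 2 corners corners-resolving ∣corners∣≤2 fractional-lower-bound

  CombStep : ℕ → ℕ → ℕ → ℕ → Set
  CombStep c r c′ r′ = (r ≡ 1 × r′ ≡ 1 × ∣ c - c′ ∣ ≡ 1) ⊎ (c ≡ c′ × ∣ r - r′ ∣ ≡ 1)

  combStep? : ∀ c r c′ r′ → Dec (CombStep c r c′ r′)
  combStep? c r c′ r′ = (r ≟ 1 ×-dec (r′ ≟ 1 ×-dec ∣ c - c′ ∣ ≟ 1)) ⊎-dec (c ≟ c′ ×-dec ∣ r - r′ ∣ ≟ 1)

  combStep-sym : ∀ {c r c′ r′} → CombStep c r c′ r′ → CombStep c′ r′ c r
  combStep-sym {c} {r} {c′} {r′} (inj₁ (r≡1 , r′≡1 , d)) = inj₁ (r′≡1 , r≡1 , trans (∣-∣-comm c′ c) d)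
  combStep-sym {c} {r} {c′} {r′} (inj₂ (c≡c′ , d))       = inj₂ (sym c≡c′ , trans (∣-∣-comm r′ r) d)

  combStep⇒gridStep : ∀ {c r c′ r′} → CombStep c r c′ r′ → GridStep c r c′ r′
  combStep⇒gridStep (inj₁ (r≡1 , r′≡1 , d)) = inj₁ (trans r≡1 (sym r′≡1) , d)
  combStep⇒gridStep (inj₂ vertical)         = inj₂ vertical

  combStep-irrefl : ∀ {c r} → ¬ CombStep c r c r
  combStep-irrefl = gridStep-irrefl ∘ combStep⇒gridStep

  toSpine : ℕ → ℕ
  toSpine (suc zero) = 0
  toSpine _          = 1

  toSpine≤1 : ∀ r → toSpine r ≤ 1
  toSpine≤1 zero             = ≤-refl
  toSpine≤1 (suc zero)       = z≤n
  toSpine≤1 (suc (suc r))    = ≤-refl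

  toSpine≡0⇒≡1 : ∀ {r} → toSpine r ≡ 0 → r ≡ 1
  toSpine≡0⇒≡1 {suc zero} _ = refl

  toSpine-≢1 : ∀ {r} → r ≢ 1 → toSpine r ≡ 1
  toSpine-≢1 {zero}        _   = refl
  toSpine-≢1 {suc zero}    r≢1 = ⊥-elim (r≢1 refl)
  toSpine-≢1 {suc (suc r)} _   = refl

  row-step-meets-spine : ∀ {r r′} → r < 3 → r′ < 3 → ∣ r - r′ ∣ ≡ 1 → r ≡ 1 ⊎ r′ ≡ 1
  row-step-meets-spine {zero}          {suc zero}       _ _ _ = inj₂ refl
  row-step-meets-spine {suc zero}      {_}              _ _ _ = inj₁ refl
  row-step-meets-spine {suc (suc zero)} {suc zero}      _ _ _ = inj₂ refl
  row-step-meets-spine {zero}          {suc (suc zero)} _ _ ()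
  row-step-meets-spine {suc (suc zero)} {zero}          _ _ ()
  row-step-meets-spine {zero}          {zero}           _ _ ()
  row-step-meets-spine {suc (suc zero)} {suc (suc zero)} _ _ ()
  row-step-meets-spine {r′ = suc (suc (suc _))} _ (s≤s (s≤s (s≤s ())))
  row-step-meets-spine {suc (suc (suc _))} (s≤s (s≤s (s≤s ()))) _

  ∣1-n∣≡1 : ∀ {r} → r < 3 → r ≢ 1 → ∣ 1 - r ∣ ≡ 1
  ∣1-n∣≡1 {zero}           _ _   = refl
  ∣1-n∣≡1 {suc zero}       _ r≢1 = ⊥-elim (r≢1 refl)
  ∣1-n∣≡1 {suc (suc zero)} _ _   = refl
  ∣1-n∣≡1 {suc (suc (suc _))} (s≤s (s≤s (s≤s ()))) _

  combStep-spine-gap : ∀ {c r c′ r′} → r < 3 → r′ < 3 → CombStep c r c′ r′ →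
    toSpine r + ∣ c - c′ ∣ + toSpine r′ ≤ 1
  combStep-spine-gap _   _    (inj₁ (refl , refl , d)) rewrite d = ≤-refl
  combStep-spine-gap {c} {r} {_} {r′} r<3 r′<3 (inj₂ (refl , d)) rewrite ∣n-n∣≡0 c | +-identityʳ (toSpine r)
    with row-step-meets-spine r<3 r′<3 d
  ... | inj₁ refl = toSpine≤1 r′
  ... | inj₂ refl = ≤-trans (≤-reflexive (+-identityʳ (toSpine r))) (toSpine≤1 r)

  combStep-lipschitz : ∀ {c r c′ r′} → CombStep c r c′ r′ → ∣ c - c′ ∣ + toSpine r′ ≤ 1 + toSpine r
  combStep-lipschitz (inj₁ (refl , refl , d)) rewrite d = ≤-refl
  combStep-lipschitz {c} {r} {_} {r′} (inj₂ (refl , _)) rewrite ∣n-n∣≡0 c =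
    ≤-trans (toSpine≤1 r′) (m≤m+n 1 (toSpine r))

  -- Distance from the top vertex of column j to the edge of shape k (0: upper tooth,
  -- 1: lower tooth, 2: spine edge) whose lower end lies in column c.
  topDistance : ℕ → ℕ → ℕ → ℕ
  topDistance zero          c j = if ⌊ c ≟ j ⌋ then 0 else suc ∣ c - j ∣
  topDistance (suc zero)    c j = suc ∣ c - j ∣
  topDistance (suc (suc _)) c j = suc ∣ c - j ∣ ⊓ suc ∣ suc c - j ∣

  topDistance-0-own : ∀ c → topDistance 0 c c ≡ 0
  topDistance-0-own c with c ≟ c
  ... | yes _   = refl
  ... | no c≢c = ⊥-elim (c≢c refl)

  topDistance-0≡0⇒≡ : ∀ {c j} → topDistance 0 c j ≡ 0 → c ≡ j
  topDistance-0≡0⇒≡ {c} {j} d≡0 with c ≟ j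
  ... | yes c≡j = c≡j

  topDistance-suc≢0 : ∀ k c j → topDistance (suc k) c j ≢ 0
  topDistance-suc≢0 zero          c j ()
  topDistance-suc≢0 (suc k)       c j ()

  topDistance-tooth≡1⇒≡ : ∀ {c j} → topDistance 1 c j ≡ 1 → c ≡ j
  topDistance-tooth≡1⇒≡ = ∣m-n∣≡0⇒m≡n ∘ suc-injective

  topDistance-spine≡1⇒ : ∀ {c j} → topDistance 2 c j ≡ 1 → c ≡ j ⊎ suc c ≡ j
  topDistance-spine≡1⇒ {c} {j} d≡1 with ∣ c - j ∣ in eq₁ | ∣ suc c - j ∣ in eq₂
  ... | zero  | _     = inj₁ (∣m-n∣≡0⇒m≡n eq₁)
  ... | suc _ | zero  = inj₂ (∣m-n∣≡0⇒m≡n eq₂)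
  ... | suc _ | suc _ with () ← d≡1

  topDistance-tooth-own : ∀ c → topDistance 1 c c ≡ 1
  topDistance-tooth-own c = cong suc (∣n-n∣≡0 c)

  topDistance-spine-own : ∀ c → topDistance 2 c c ≡ 1
  topDistance-spine-own c rewrite ∣n-n∣≡0 c = refl

  topDistance-tooth-next : ∀ c → topDistance 1 c (suc c) ≡ 2
  topDistance-tooth-next c = cong suc (∣n-1+n∣≡1 c)

  topDistance-spine-next : ∀ c → topDistance 2 c (suc c) ≡ 1
  topDistance-spine-next c = cong suc (trans (cong (∣ c - suc c ∣ ⊓_) (∣n-n∣≡0 c)) (⊓-zeroʳ ∣ c - suc c ∣))

  topDistance-injective : ∀ m {k c k′ c′} → k ≤ 2 → k′ ≤ 2 → c < m → c′ < m →
    (k ≡ 2 → suc c < m) → (k′ ≡ 2 → suc c′ < m) →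
    (∀ j → j < m → topDistance k c j ≡ topDistance k′ c′ j) → k ≡ k′ × c ≡ c′
  topDistance-injective m {0} {c} {0} {c′} _ _ c<m _ _ _ same =
    refl , sym (topDistance-0≡0⇒≡ (trans (sym (same c c<m)) (topDistance-0-own c)))
  topDistance-injective m {0} {c} {suc k′} {c′} _ _ c<m _ _ _ same =
    ⊥-elim (topDistance-suc≢0 k′ c′ c (trans (sym (same c c<m)) (topDistance-0-own c)))
  topDistance-injective m {suc k} {c} {0} {c′} _ _ _ c′<m _ _ same =
    ⊥-elim (topDistance-suc≢0 k c c′ (trans (same c′ c′<m) (topDistance-0-own c′)))
  topDistance-injective m {1} {c} {1} {c′} _ _ c<m _ _ _ same =
    refl , sym (topDistance-tooth≡1⇒≡ (trans (sym (same c c<m)) (topDistance-tooth-own c)))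
  topDistance-injective m {1} {c} {2} {c′} _ _ _ c′<m _ spine′ same = ⊥-elim (1+n≢n (begin
    2                          ≡⟨ topDistance-tooth-next c′ ⟨
    topDistance 1 c′ (suc c′)  ≡⟨ cong (λ z → topDistance 1 z (suc c′)) c≡c′ ⟨
    topDistance 1 c (suc c′)   ≡⟨ same (suc c′) (spine′ refl) ⟩
    topDistance 2 c′ (suc c′)  ≡⟨ topDistance-spine-next c′ ⟩
    1                          ∎))
    where
    open ≡-Reasoning
    c≡c′ : c ≡ c′
    c≡c′ = topDistance-tooth≡1⇒≡ (trans (same c′ c′<m) (topDistance-spine-own c′))
  topDistance-injective m {2} {c} {1} {c′} k≤2 k′≤2 c<m c′<m spine spine′ same
    with topDistance-injective m k′≤2 k≤2 c′<m c<m spine′ spine (λ j j<m → sym (same j j<m))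
  ... | () , _
  topDistance-injective m {2} {c} {2} {c′} _ _ c<m c′<m _ _ same
    with topDistance-spine≡1⇒ (trans (sym (same c c<m)) (topDistance-spine-own c))
       | topDistance-spine≡1⇒ (trans (same c′ c′<m) (topDistance-spine-own c′))
  ... | inj₁ c′≡c    | _            = refl , sym c′≡c
  ... | _            | inj₁ c≡c′    = refl , c≡c′
  ... | inj₂ 1+c′≡c  | inj₂ 1+c≡c′  = ⊥-elim (<-asym (≤-reflexive 1+c′≡c) (≤-reflexive 1+c≡c′))
  topDistance-injective m {suc (suc (suc _))} (s≤s (s≤s ())) _ _ _ _ _ _
  topDistance-injective m {k′ = suc (suc (suc _))} _ (s≤s (s≤s ())) _ _ _ _ _

  below-last-row : ∀ {r} → suc r < 3 → r ≡ 0 ⊎ r ≡ 1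
  below-last-row {zero}     _ = inj₁ refl
  below-last-row {suc zero} _ = inj₂ refl
  below-last-row {suc (suc _)} (s≤s (s≤s (s≤s ())))

  module Comb (K : ℕ) where

    m : ℕ
    m = suc (suc K)

    open CoordinateGraph m CombStep combStep? combStep-sym combStep-irrefl public

    -- A shortest path between distinct vertices goes to the spine (row 1), along it, and out.
    combDist : V → V → ℕ
    combDist u v with u Fin.≟ v
    ... | yes _ = 0
    ... | no _  = toSpine (row u) + ∣ col u - col v ∣ + toSpine (row v)

    combDist-self : ∀ u → combDist u u ≡ 0
    combDist-self u with u Fin.≟ u
    ... | yes _   = refl
    ... | no u≢u = ⊥-elim (u≢u refl)

    combDist-≢ : ∀ u v → u ≢ v → combDist u v ≡ toSpine (row u) + ∣ col u - col v ∣ + toSpine (row v)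
    combDist-≢ u v u≢v with u Fin.≟ v
    ... | yes u≡v = ⊥-elim (u≢v u≡v)
    ... | no _    = refl

    combDist≡0⇒≡ : ∀ u v → combDist u v ≡ 0 → u ≡ v
    combDist≡0⇒≡ u v d≡0 with u Fin.≟ v
    ... | yes u≡v = u≡v
    ... | no _    = coord-injective u v
      (∣m-n∣≡0⇒m≡n (m+n≡0⇒n≡0 (toSpine (row u)) (m+n≡0⇒m≡0 _ d≡0)))
      (trans (toSpine≡0⇒≡1 (m+n≡0⇒m≡0 _ (m+n≡0⇒m≡0 _ d≡0))) (sym (toSpine≡0⇒≡1 (m+n≡0⇒n≡0 _ d≡0))))

    combDist-step : ∀ u w v → adj graph w v ≡ true → combDist u v ≤ suc (combDist u w)
    combDist-step u w v w~v with u Fin.≟ v | u Fin.≟ w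
    ... | yes _    | _        = z≤n
    ... | no _     | yes refl = combStep-spine-gap (row< u) (row< v) (adj⇒step u v w~v)
    ... | no _     | no _     = begin
      toSpine (row u) + ∣ col u - col v ∣ + toSpine (row v)
        ≤⟨ +-monoˡ-≤ (toSpine (row v)) (+-monoʳ-≤ (toSpine (row u)) (∣-∣-triangle (col u) (col w) (col v))) ⟩
      toSpine (row u) + (∣ col u - col w ∣ + ∣ col w - col v ∣) + toSpine (row v)
        ≡⟨ regroup (toSpine (row u)) ∣ col u - col w ∣ ∣ col w - col v ∣ (toSpine (row v)) ⟩
      toSpine (row u) + ∣ col u - col w ∣ + (∣ col w - col v ∣ + toSpine (row v))
        ≤⟨ +-monoʳ-≤ (toSpine (row u) + ∣ col u - col w ∣) (combStep-lipschitz (adj⇒step w v w~v)) ⟩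
      toSpine (row u) + ∣ col u - col w ∣ + (1 + toSpine (row w))
        ≡⟨ finish (toSpine (row u)) ∣ col u - col w ∣ (toSpine (row w)) ⟩
      suc (toSpine (row u) + ∣ col u - col w ∣ + toSpine (row w)) ∎
      where
      open ≤-Reasoning
      regroup : ∀ a x z b → a + (x + z) + b ≡ a + x + (z + b)
      regroup = solve-∀
      finish : ∀ a x c → a + x + (1 + c) ≡ suc (a + x + c)
      finish = solve-∀

    spine : (c : ℕ) → c < m → V
    spine c c<m = vertex c 1 c<m (s≤s (s≤s z≤n))

    col-spine : ∀ c c<m → col (spine c c<m) ≡ c
    col-spine c c<m = col-vertex c 1 c<m (s≤s (s≤s z≤n))

    row-spine : ∀ c c<m → row (spine c c<m) ≡ 1
    row-spine c c<m = row-vertex c 1 c<m (s≤s (s≤s z≤n))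

    combDist-to-spine : ∀ u c c<m → combDist u (spine c c<m) ≤ toSpine (row u) + ∣ col u - c ∣
    combDist-to-spine u c c<m with u Fin.≟ spine c c<m
    ... | yes _ = z≤n
    ... | no _  rewrite col-spine c c<m | row-spine c c<m = ≤-reflexive (+-identityʳ _)

    combDist-pred : ∀ u v j → combDist u v ≡ suc j → ∃[ w ] (combDist u w ≤ j × adj graph w v ≡ true)
    combDist-pred u v j d≡1+j with u Fin.≟ v
    ... | yes _ = ⊥-elim (0≢1+n d≡1+j)
    ... | no u≢v with row v ≟ 1
    ...   | no rv≢1 = w , ≤-trans (combDist-to-spine u (col v) (col< v)) (≤-reflexive (suc-injective gap)) , w~v
      where
      w : V
      w = spine (col v) (col< v)
      w~v : adj graph w v ≡ true
      w~v = step⇒adj w v (inj₂ (col-spine (col v) (col< v) ,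
                                 trans (cong (∣_- row v ∣) (row-spine (col v) (col< v))) (∣1-n∣≡1 (row< v) rv≢1)))
      gap : suc (toSpine (row u) + ∣ col u - col v ∣) ≡ suc j
      gap = trans (+-comm 1 _) (trans (cong (toSpine (row u) + ∣ col u - col v ∣ +_) (sym (toSpine-≢1 rv≢1))) d≡1+j)
    ...   | yes rv≡1 with col u ≟ col v
    ...     | yes cu≡cv = u , ≤-trans (≤-reflexive (combDist-self u)) z≤n , u~v
      where
      ru≢1 : row u ≢ 1
      ru≢1 ru≡1 = u≢v (coord-injective u v cu≡cv (trans ru≡1 (sym rv≡1)))
      u~v : adj graph u v ≡ true
      u~v = step⇒adj u v (inj₂ (cu≡cv ,
        trans (cong (∣ row u -_∣) rv≡1) (trans (∣-∣-comm (row u) 1) (∣1-n∣≡1 (row< u) ru≢1))))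
    ...     | no cu≢cv with step-toward (col u) (col v) cu≢cv
    ...       | c′ , closer , adjacent , between =
                w , ≤-trans (combDist-to-spine u c′ c′<m) (≤-reflexive (suc-injective gap)) , w~v
      where
      c′<m : c′ < m
      c′<m = [ (λ c′≤cu → ≤-<-trans c′≤cu (col< u)) , (λ c′≤cv → ≤-<-trans c′≤cv (col< v)) ]′ between
      w : V
      w = spine c′ c′<m
      w~v : adj graph w v ≡ true
      w~v = step⇒adj w v
        (inj₁ (row-spine c′ c′<m , rv≡1 , trans (cong (∣_- col v ∣) (col-spine c′ c′<m)) adjacent))
      gap : suc (toSpine (row u) + ∣ col u - c′ ∣) ≡ suc j
      gap = begin
        suc (toSpine (row u) + ∣ col u - c′ ∣)   ≡⟨ +-suc (toSpine (row u)) ∣ col u - c′ ∣ ⟨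
        toSpine (row u) + suc ∣ col u - c′ ∣     ≡⟨ cong (toSpine (row u) +_) closer ⟩
        toSpine (row u) + ∣ col u - col v ∣       ≡⟨ +-identityʳ _ ⟨
        toSpine (row u) + ∣ col u - col v ∣ + 0
          ≡⟨ cong (λ r → toSpine (row u) + ∣ col u - col v ∣ + toSpine r) rv≡1 ⟨
        toSpine (row u) + ∣ col u - col v ∣ + toSpine (row v) ≡⟨ d≡1+j ⟩
        suc j                                     ∎
        where open ≡-Reasoning

    combDist≤n : ∀ u v → combDist u v ≤ m * 3
    combDist≤n u v with u Fin.≟ v
    ... | yes _ = z≤n
    ... | no _  = ≤-trans
      (+-mono-≤ (+-mono-≤ (toSpine≤1 (row u)) (≤-pred (∣m-n∣<bound (col< u) (col< v)))) (toSpine≤1 (row v)))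
      (≤-trans (≤-reflexive (+-comm (2 + K) 1)) (s≤s (s≤s (s≤s (≤-trans (m≤m*n K 3) (m≤n+m _ 3))))))

    open ShortestPaths graph combDist combDist-self combDist≡0⇒≡ combDist-step combDist-pred combDist≤n public

    data EdgeShape (x y : V) : ℕ → Set where
      upper-tooth : row x ≡ 0 → col y ≡ col x → row y ≡ 1 → EdgeShape x y 0
      lower-tooth : row x ≡ 1 → col y ≡ col x → row y ≡ 2 → EdgeShape x y 1
      spine-edge  : row x ≡ 1 → col y ≡ suc (col x) → row y ≡ 1 → EdgeShape x y 2

    shape≤2 : ∀ {x y k} → EdgeShape x y k → k ≤ 2
    shape≤2 (upper-tooth _ _ _) = z≤n
    shape≤2 (lower-tooth _ _ _) = s≤s z≤n
    shape≤2 (spine-edge _ _ _)  = s≤s (s≤s z≤n)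

    spine-edge-fits : ∀ {x y k} → EdgeShape x y k → k ≡ 2 → suc (col x) < m
    spine-edge-fits {y = y} (spine-edge _ cy _) _ = subst (_< m) cy (col< y)

    edge-shape : ∀ x y → toℕ x < toℕ y → adj graph x y ≡ true → ∃[ k ] EdgeShape x y k
    edge-shape x y x<y x~y with adj⇒step x y x~y
    ... | inj₁ (rx≡1 , ry≡1 , d) with ∣m-n∣≡1⇒ (col x) (col y) d
    ...   | inj₁ cy≡1+cx = 2 , spine-edge rx≡1 cy≡1+cx ry≡1
    ...   | inj₂ cx≡1+cy = ⊥-elim (<-asym x<y (left-of⇒< y x (trans rx≡1 (sym ry≡1)) cx≡1+cy))
    edge-shape x y x<y x~y | inj₂ (cx≡cy , d) with ∣m-n∣≡1⇒ (row x) (row y) d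
    ...   | inj₂ rx≡1+ry = ⊥-elim (<-asym x<y (above⇒< y x cx≡cy rx≡1+ry))
    ...   | inj₁ ry≡1+rx with below-last-row (subst (_< 3) ry≡1+rx (row< y))
    ...     | inj₁ rx≡0 = 0 , upper-tooth rx≡0 (sym cx≡cy) (trans ry≡1+rx (cong suc rx≡0))
    ...     | inj₂ rx≡1 = 1 , lower-tooth rx≡1 (sym cx≡cy) (trans ry≡1+rx (cong suc rx≡1))

    top : (j : ℕ) → j < m → V
    top j j<m = vertex j 0 j<m (s≤s z≤n)

    combDist-top : ∀ u j j<m → u ≢ top j j<m → combDist u (top j j<m) ≡ suc (toSpine (row u) + ∣ col u - j ∣)
    combDist-top u j j<m u≢top rewrite combDist-≢ u (top j j<m) u≢top
      | col-vertex j 0 j<m (s≤s z≤n) | row-vertex j 0 j<m (s≤s z≤n) = +-comm _ 1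

    off-top-row : ∀ u j j<m → row u ≢ 0 → u ≢ top j j<m
    off-top-row u j j<m ru≢0 u≡top = ru≢0 (trans (cong row u≡top) (row-vertex j 0 j<m (s≤s z≤n)))

    top-profile : ∀ {x y k} → EdgeShape x y k → ∀ j j<m →
      combDist x (top j j<m) ⊓ combDist y (top j j<m) ≡ topDistance k (col x) j
    top-profile {x} {y} (upper-tooth rx≡0 cy ry≡1) j j<m with col x ≟ j
    ... | yes cx≡j rewrite coord-injective x (top j j<m) (trans cx≡j (sym (col-vertex j 0 j<m (s≤s z≤n))))
                                           (trans rx≡0 (sym (row-vertex j 0 j<m (s≤s z≤n))))
                         | combDist-self (top j j<m) = refl
    ... | no cx≢j rewrite combDist-top x j j<m (λ x≡top → cx≢j (trans (cong col x≡top) (col-vertex j 0 j<m (s≤s z≤n))))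
                        | combDist-top y j j<m (off-top-row y j j<m (λ ry≡0 → 1+n≢0 (trans (sym ry≡1) ry≡0)))
                        | rx≡0 | ry≡1 | cy = m≥n⇒m⊓n≡n (n≤1+n _)
    top-profile {x} {y} (lower-tooth rx≡1 cy ry≡2) j j<m
      rewrite combDist-top x j j<m (off-top-row x j j<m (λ rx≡0 → 1+n≢0 (trans (sym rx≡1) rx≡0)))
            | combDist-top y j j<m (off-top-row y j j<m (λ ry≡0 → 1+n≢0 (trans (sym ry≡2) ry≡0)))
            | rx≡1 | ry≡2 | cy = m≤n⇒m⊓n≡m (n≤1+n _)
    top-profile {x} {y} (spine-edge rx≡1 cy ry≡1) j j<m
      rewrite combDist-top x j j<m (off-top-row x j j<m (λ rx≡0 → 1+n≢0 (trans (sym rx≡1) rx≡0)))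
            | combDist-top y j j<m (off-top-row y j j<m (λ ry≡0 → 1+n≢0 (trans (sym ry≡1) ry≡0)))
            | rx≡1 | ry≡1 | cy = refl

    edgeDist≡ : ∀ (e : Edge graph) v →
      edgeDist graph e v ≡ combDist (proj₁ e) v ⊓ combDist (proj₁ (proj₂ e)) v
    edgeDist≡ (x , y , _) v = cong₂ _⊓_ (dist≡D x v) (dist≡D y v)

    shape-determines : ∀ {x y x′ y′ k} → EdgeShape x y k → EdgeShape x′ y′ k →
      col x ≡ col x′ → x ≡ x′ × y ≡ y′
    shape-determines (upper-tooth r₁ c₁ s₁) (upper-tooth r₂ c₂ s₂) cx≡cx′ =
      coord-injective _ _ cx≡cx′ (trans r₁ (sym r₂)) ,
      coord-injective _ _ (trans c₁ (trans cx≡cx′ (sym c₂))) (trans s₁ (sym s₂))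
    shape-determines (lower-tooth r₁ c₁ s₁) (lower-tooth r₂ c₂ s₂) cx≡cx′ =
      coord-injective _ _ cx≡cx′ (trans r₁ (sym r₂)) ,
      coord-injective _ _ (trans c₁ (trans cx≡cx′ (sym c₂))) (trans s₁ (sym s₂))
    shape-determines (spine-edge r₁ c₁ s₁) (spine-edge r₂ c₂ s₂) cx≡cx′ =
      coord-injective _ _ cx≡cx′ (trans r₁ (sym r₂)) ,
      coord-injective _ _ (trans c₁ (trans (cong suc cx≡cx′) (sym c₂))) (trans s₁ (sym s₂))

    top-row-determines : ∀ (e₁ e₂ : Edge graph) →
      (∀ j j<m → edgeDist graph e₁ (top j j<m) ≡ edgeDist graph e₂ (top j j<m)) →
      endpoints graph e₁ ≡ endpoints graph e₂
    top-row-determines e₁@(x , y , x<y , x~y) e₂@(x′ , y′ , x′<y′ , x′~y′) agree =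
      same-edge (proj₂ (edge-shape x y x<y x~y)) (proj₂ (edge-shape x′ y′ x′<y′ x′~y′))
      where
      same-edge : ∀ {k k′} → EdgeShape x y k → EdgeShape x′ y′ k′ → (x , y) ≡ (x′ , y′)
      same-edge {k} {k′} shape shape′ = conclude
        (topDistance-injective m (shape≤2 shape) (shape≤2 shape′) (col< x) (col< x′)
           (spine-edge-fits shape) (spine-edge-fits shape′)
           λ j j<m → trans (sym (top-profile shape j j<m))
                    (trans (sym (edgeDist≡ e₁ (top j j<m)))
                    (trans (agree j j<m)
                    (trans (edgeDist≡ e₂ (top j j<m)) (top-profile shape′ j j<m)))))
        where
        conclude : k ≡ k′ × col x ≡ col x′ → (x , y) ≡ (x′ , y′)
        conclude (refl , cx≡cx′) = uncurry (cong₂ _,_) (shape-determines shape shape′ cx≡cx′)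

    on-top-row : V → Bool
    on-top-row v = ⌊ row v ≟ 0 ⌋

    top-row : Subset (m * 3)
    top-row = Vec.tabulate on-top-row

    top∈top-row : ∀ j j<m → top j j<m ∈ top-row
    top∈top-row j j<m = lookup⇒[]= (top j j<m) top-row
      (trans (lookup∘tabulate on-top-row (top j j<m)) (cong (λ r → ⌊ r ≟ 0 ⌋) (row-vertex j 0 j<m (s≤s z≤n))))

    top-row-resolving : IsEdgeResolvingSet graph top-row
    top-row-resolving = resolving-by-profile graph top-row λ e₁ e₂ agree →
      top-row-determines e₁ e₂ λ j j<m → agree (top j j<m) (top∈top-row j j<m)

    ∣top-row∣≤m : ∣ top-row ∣ ≤ m
    ∣top-row∣≤m = ℕtoℚ-cancel-≤ (ℚ.≤-reflexive (begin
      ℕtoℚ ∣ top-row ∣                                          ≡⟨ ∑-indicator top-row ⟨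
      sum (indicator top-row)                                    ≡⟨ ∑-combine m 3 (indicator top-row) ⟩
      ∑[ c < m ] ∑[ r < 3 ] indicator top-row (combine c r)      ≡⟨ sum-cong-≗ one-per-column ⟩
      ∑[ c < m ] 1ℚ                                              ≡⟨ ∑-ones m ⟩
      ℕtoℚ m                                                     ∎))
      where
      open ≡-Reasoning
      one-per-column : ∀ c → ∑[ r < 3 ] indicator top-row (combine c r) ≡ 1ℚ
      one-per-column c = sum-cong-≗ λ r → cong (λ b → select b 1ℚ)
        (trans (lookup∘tabulate on-top-row (combine c r)) (cong (λ r′ → ⌊ r′ ≟ 0 ⌋) (row-cell c r)))

    module Teeth (j : Fin m) where

      hub upper lower : V
      hub   = cell j (suc zero)
      upper = cell j zero
      lower = cell j (suc (suc zero))

      private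
        tooth : ∀ r → ∣ 1 - toℕ r ∣ ≡ 1 → adj graph hub (cell j r) ≡ true
        tooth r d = step⇒adj hub (cell j r) (inj₂ (trans (col-cell j (suc zero)) (sym (col-cell j r)) ,
          trans (cong₂ ∣_-_∣ (row-cell j (suc zero)) (row-cell j r)) d))

        row≢ : ∀ {r r′} → toℕ r ≢ toℕ r′ → cell j r ≢ cell j r′
        row≢ {r} {r′} r≢r′ eq = r≢r′ (trans (sym (row-cell j r)) (trans (cong row eq) (row-cell j r′)))

      hub≢upper : hub ≢ upper
      hub≢upper = row≢ λ ()

      hub≢lower : hub ≢ lower
      hub≢lower = row≢ λ ()

      hub~upper : adj graph hub upper ≡ true
      hub~upper = tooth zero refl

      hub~lower : adj graph hub lower ≡ true
      hub~lower = tooth (suc (suc zero)) refl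

      edges : Edge graph × Edge graph
      edges = edge graph hub upper hub≢upper hub~upper , edge graph hub lower hub≢lower hub~lower

      distinct : uncurry (DistinctEdges graph) edges
      distinct = edge-distinct graph hub upper lower hub≢upper hub~upper hub≢lower hub~lower (row≢ λ ())

      -- Off column j both teeth are nearest to v through their common end, the hub.
      off-column : ∀ v → col v ≢ toℕ j → uncurry (inRe graph) edges v ≡ false
      off-column v cv≢j = ≡⇒¬inRe graph (proj₁ edges) (proj₂ edges) v (trans
        (edgeDist-edge-near graph hub upper hub≢upper hub~upper v (dist-cell hub-on-spine) (dist-cell upper-off-spine))
        (sym (edgeDist-edge-near graph hub lower hub≢lower hub~lower v (dist-cell hub-on-spine) (dist-cell lower-off-spine))))
        where
        X : ℕ
        X = ∣ toℕ j - col v ∣ + toSpine (row v)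
        dist-cell : ∀ {r s} → toSpine (toℕ r) ≡ s → dist graph (cell j r) v ≡ s + X
        dist-cell {r} {s} spine-gap = begin
          dist graph (cell j r) v                                 ≡⟨ dist≡D (cell j r) v ⟩
          combDist (cell j r) v
            ≡⟨ combDist-≢ (cell j r) v (λ eq → cv≢j (trans (cong col (sym eq)) (col-cell j r))) ⟩
          toSpine (row (cell j r)) + ∣ col (cell j r) - col v ∣ + toSpine (row v)
            ≡⟨ cong₂ (λ p q → toSpine p + ∣ q - col v ∣ + toSpine (row v)) (row-cell j r) (col-cell j r) ⟩
          toSpine (toℕ r) + ∣ toℕ j - col v ∣ + toSpine (row v)   ≡⟨ +-assoc (toSpine (toℕ r)) _ _ ⟩
          toSpine (toℕ r) + X                                     ≡⟨ cong (_+ X) spine-gap ⟩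
          s + X                                                   ∎
          where open ≡-Reasoning
        hub-on-spine : toSpine (toℕ (suc {3} zero)) ≡ 0
        hub-on-spine = refl
        upper-off-spine : toSpine (toℕ (zero {2})) ≡ 1
        upper-off-spine = refl
        lower-off-spine : toSpine (toℕ (suc {3} (suc zero))) ≡ 1
        lower-off-spine = refl

    teeth-multiplicity : ∀ v → count (λ j → uncurry (inRe graph) (Teeth.edges j) v) ≤ 1
    teeth-multiplicity v = count-single _ (fromℕ< (col< v)) λ j j≢ →
      Teeth.off-column j v λ cv≡j → j≢ (Fin.toℕ-injective (trans (sym cv≡j) (sym (Fin.toℕ-fromℕ< (col< v)))))

    fractional-lower-bound : ∀ g → IsEdgeResolvingFunction graph g → ℕtoℚ m ≤ℚ total graph g
    fractional-lower-bound g resolving = subst (ℕtoℚ m ≤ℚ_) (ℚ.*-identityˡ (total graph g))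
      (packing-bound graph Teeth.edges Teeth.distinct 1 teeth-multiplicity g resolving)

    edim≡m : IsEdim graph m × IsEdimF graph (ℕtoℚ m)
    edim≡m = edim-from-bounds graph m top-row top-row-resolving ∣top-row∣≤m fractional-lower-bound

  comb⊆grid : ∀ K → Comb.graph K ⊆G Grid.graph K
  comb⊆grid K = (λ v → v) , (λ eq → eq) , λ u v u~v →
    Grid.step⇒adj K u v (combStep⇒gridStep (Comb.adj⇒step K u v u~v))

  archimedean : ∀ (M : ℚ) → ∃[ k ] (M <ℚ ℕtoℚ k)
  archimedean (mkℚ (ℤ.+ n) d c) =
    suc n , subst (mkℚ (ℤ.+ n) d c <ℚ_) (sym (ℕtoℚ≡mkℚ (suc n))) (*<* n<1+n*d)
    where
    n<1+n*d : (ℤ.+ n) ℤ.* (ℤ.+ 1) ℤ.< (ℤ.+ suc n) ℤ.* (ℤ.+ suc d)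
    n<1+n*d rewrite ℤ.*-identityʳ (ℤ.+ n) = ℤ.+<+ (<-≤-trans (n<1+n n) (m≤m*n (suc n) (suc d)))
  archimedean (mkℚ ℤ.-[1+ n ] d c) = 0 , subst (mkℚ ℤ.-[1+ n ] d c <ℚ_) (sym (ℕtoℚ≡mkℚ 0)) (*<* negative<0)
    where
    negative<0 : ℤ.-[1+ n ] ℤ.* (ℤ.+ 1) ℤ.< (ℤ.+ 0) ℤ.* (ℤ.+ suc d)
    negative<0 rewrite ℤ.*-identityʳ ℤ.-[1+ n ] = ℤ.-<+

  ℕtoℚ[2+k]-ℕtoℚ2 : ∀ k → ℕtoℚ (2 + k) -ℚ ℕtoℚ 2 ≡ ℕtoℚ k
  ℕtoℚ[2+k]-ℕtoℚ2 k = begin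
    ℕtoℚ (2 + k) +ℚ -ℚ ℕtoℚ 2
      ≡⟨ cong (_+ℚ -ℚ ℕtoℚ 2) (trans (ℕtoℚ-+ 2 k) (ℚ.+-comm (ℕtoℚ 2) (ℕtoℚ k))) ⟩
    (ℕtoℚ k +ℚ ℕtoℚ 2) +ℚ -ℚ ℕtoℚ 2   ≡⟨ ℚ.+-assoc (ℕtoℚ k) (ℕtoℚ 2) (-ℚ ℕtoℚ 2) ⟩
    ℕtoℚ k +ℚ (ℕtoℚ 2 +ℚ -ℚ ℕtoℚ 2)   ≡⟨ cong (ℕtoℚ k +ℚ_) (ℚ.+-inverseʳ (ℕtoℚ 2)) ⟩
    ℕtoℚ k +ℚ 0ℚ                      ≡⟨ ℚ.+-identityʳ (ℕtoℚ k) ⟩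
    ℕtoℚ k                            ∎
    where open ≡-Reasoning

  <-gap : ∀ {M K} → M <ℚ ℕtoℚ K → M <ℚ ℕtoℚ (2 + K) -ℚ ℕtoℚ 2
  <-gap {M} {K} M<K = subst (M <ℚ_) (sym (ℕtoℚ[2+k]-ℕtoℚ2 K)) M<K

  grid-and-comb : ∀ K →
    Connected (Grid.graph K) × Connected (Comb.graph K) × Comb.graph K ⊆G Grid.graph K ×
    IsEdim (Grid.graph K) 2 × IsEdim (Comb.graph K) (2 + K) ×
    IsEdimF (Grid.graph K) (ℕtoℚ 2) × IsEdimF (Comb.graph K) (ℕtoℚ (2 + K))
  grid-and-comb K = Grid.connected K , Comb.connected K , comb⊆grid K ,
    proj₁ (Grid.edim≡2 K) , proj₁ (Comb.edim≡m K) , proj₂ (Grid.edim≡2 K) , proj₂ (Comb.edim≡m K)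

open import Defs
open import Data.Nat using (ℕ; _+_)
open import Data.Product using (∃-syntax; _×_; _,_)
open import Data.Rational using (ℚ; _<_; _-_)
open EdgeDimensions using (module Grid; module Comb; archimedean; grid-and-comb; <-gap)

mainTheorem6 : ∀ (M : ℚ) → ∃[ G ] ∃[ H ] (Connected G × Connected H × H ⊆G G ×
    ∃[ kG ] ∃[ kH ] ∃[ qG ] ∃[ qH ] (IsEdim G kG × IsEdim H kH × IsEdimF G qG × IsEdimF H qH ×
    M < (ℕtoℚ kH - ℕtoℚ kG) × M < (qH - qG)))
mainTheorem6 M =
  let K , M<K = archimedean M
      G-connected , H-connected , H⊆G , edim-G , edim-H , edimf-G , edimf-H = grid-and-comb K
  in Grid.graph K , Comb.graph K , G-connected , H-connected , H⊆G ,
     2 , 2 + K , ℕtoℚ 2 , ℕtoℚ (2 + K) , edim-G , edim-H , edimf-G , edimf-H ,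
     -- K is passed explicitly: inferring it would make Agda normalise ℕtoℚ (2 + K).
     <-gap {K = K} M<K , <-gap {K = K} M<K
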